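{- Fix an integer $r\ge1$, a partition $\lambda=(\lambda_1,\dots,\lambda_k)$ with $k\le r$, and a partition $\mu=(\mu_1,\dots,\mu_l)$. Then there is a polynomial $A^{\lambda,\mu}_{(r)}(x)\in\mathbb Q[x]$ such that $$n!\cdot N^\bullet_{n-\lambda_1,\dots,n-\lambda_k,n,\dots,n}\big((\mu_1,\dots,\mu_l,1^{n-|\mu|})\big)=A^{\lambda,\mu}_{(r)}(n)$$ for every positive integer $n$ with $n\ge|\mu|$, where the subscript consists of $r$ entries, the last $r-k$ of which equal $n$.
   Context: For a partition $\nu$ of $d$ and integers $k_1,\dots,k_r$, $N^\bullet_{k_1,\dots,k_r}(\nu)=\frac{1}{d!}\#\{(\alpha_1,\dots,\alpha_r,\alpha)\in(S_d)^{r+1}:\alpha_1\cdots\alpha_r\alpha=e,\ \alpha_i\text{ has exactly }k_i\text{ cycles (fixed points counted)},\ \alpha\text{ has cycle type }\nu\}$ (so it is $0$ if no such tuples exist); equivalently the automorphism-weighted count of possibly disconnected degree-$d$ branched covers of $\mathbb{CP}^1$ over $r+1$ points with $k_i$ preimages over the $i$-th point and profile $\nu$ over the last. $(\mu_1,\dots,\mu_l,1^{n-|\mu|})$ denotes the partition of $n$ obtained from $\mu$ by appending $n-|\mu|$ parts equal to $1$. -}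

module Defs where

open import Data.Nat using (ℕ; zero; suc; _+_; _∸_; _≤_; _≥_; _≡ᵇ_; _≤ᵇ_)
open import Data.Bool using (Bool; true; false; _∧_; not; if_then_else_)
open import Data.Fin using (Fin; toℕ; _≟_)
open import Data.Fin.Base using () renaming (zero to fzero; suc to fsuc)
open import Data.List using (List; []; _∷_; _++_; map; concatMap; filter; length; replicate; foldr; upTo; allFin; all; any; sum; zip)
open import Data.Integer using (+_)
open import Data.Rational using (ℚ; _/_; _+_; _*_; 0ℚ)
open import Relation.Nullary.Decidable using (⌊_⌋)
open import Relation.Binary.PropositionalEquality using (_≡_)

-- Permutations of Fin n are represented as endofunctions Fin n → Fin n
-- which are injective (equivalently bijective, since Fin n is finite).

allFuns : (n m : ℕ) → List (Fin n → Fin m)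
allFuns zero    m = (λ ()) ∷ []
allFuns (suc n) m =
  concatMap (λ f → map (λ j → λ { fzero → j ; (fsuc i) → f i }) (allFin m)) (allFuns n m)

eqFin : {n : ℕ} → Fin n → Fin n → Bool
eqFin i j = ⌊ i ≟ j ⌋

isInjective : {n : ℕ} → (Fin n → Fin n) → Bool
isInjective {n} f =
  all (λ i → all (λ j → not (eqFin (f i) (f j)) Data.Bool.∨ eqFin i j) (allFin n)) (allFin n)
  where import Data.Bool

Sym : (n : ℕ) → List (Fin n → Fin n)
Sym n = filter (λ f → Data.Bool.T? (isInjective f)) (allFuns n n)
  where import Data.Bool

iter : {n : ℕ} → (Fin n → Fin n) → ℕ → Fin n → Fin n
iter f zero    i = i
iter f (suc m) i = f (iter f m i)

isOrbitMin : {n : ℕ} → (Fin n → Fin n) → Fin n → Bool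
isOrbitMin {n} σ i = all (λ m → toℕ i ≤ᵇ toℕ (iter σ m i)) (upTo n)

-- length of the cycle of σ containing i: least m ≥ 1 with σ^m i = i
-- (searched among 1..n; for a permutation it always exists there)
cycleLen : {n : ℕ} → (Fin n → Fin n) → Fin n → ℕ
cycleLen {n} σ i = go (map suc (upTo n))
  where
  go : List ℕ → ℕ
  go []       = 0
  go (m ∷ ms) = if eqFin (iter σ m i) i then m else go ms

-- number of cycles (fixed points counted): one per orbit-minimum
numCycles : {n : ℕ} → (Fin n → Fin n) → ℕ
numCycles {n} σ = length (filter (λ i → Data.Bool.T? (isOrbitMin σ i)) (allFin n))
  where import Data.Bool

numCyclesOfLen : {n : ℕ} → (Fin n → Fin n) → ℕ → ℕ
numCyclesOfLen {n} σ j =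
  length (filter (λ i → Data.Bool.T? (isOrbitMin σ i ∧ (cycleLen σ i ≡ᵇ j))) (allFin n))
  where import Data.Bool

mult : ℕ → List ℕ → ℕ
mult j xs = length (filter (λ x → Data.Bool.T? (x ≡ᵇ j)) xs)
  where import Data.Bool

hasCycleType : {n : ℕ} → (Fin n → Fin n) → List ℕ → Bool
hasCycleType {n} σ ν = all (λ j → numCyclesOfLen σ j ≡ᵇ mult j ν) (map suc (upTo n))
  -- lengths j > n: no cycles; and parts of ν are ≤ |ν| = n in our use

tuples : {A : Set} → ℕ → List A → List (List A)
tuples zero    xs = [] ∷ []
tuples (suc r) xs = concatMap (λ x → map (x ∷_) (tuples r xs)) xs

-- product α₁ ⋯ α_r α (composition of functions, α applied first)
prod : {n : ℕ} → List (Fin n → Fin n) → (Fin n → Fin n)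
prod []       i = i
prod (f ∷ fs) i = f (prod fs i)

isId : {n : ℕ} → (Fin n → Fin n) → Bool
isId {n} f = all (λ i → eqFin (f i) i) (allFin n)

cycleCountsAre : {n : ℕ} → List (Fin n → Fin n) → List ℕ → Bool
cycleCountsAre []       []       = true
cycleCountsAre (f ∷ fs) (k ∷ ks) = (numCycles f ≡ᵇ k) ∧ cycleCountsAre fs ks
cycleCountsAre _        _        = false

-- d! · N^•_{k₁,…,k_r}(ν): the number of tuples (α₁,…,α_r,α) ∈ S_d^{r+1}
-- with α₁⋯α_r α = e, α_i having exactly k_i cycles and α of cycle type ν
-- (r = length ks).
countTuples : (d : ℕ) → List ℕ → List ℕ → ℕ
countTuples d ks ν =
  length (filter (λ t → Data.Bool.T? (good t))
                 (tuples (suc (length ks)) (Sym d)))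
  where
  import Data.Bool
  good : List (Fin d → Fin d) → Bool
  good []       = false
  good (α ∷ αs) = cycleCountsAre αs ks ∧ hasCycleType α ν ∧ isId (prod (αs ++ (α ∷ [])))

data Partition : List ℕ → Set where
  nil  : Partition []
  one  : ∀ {a} → 1 ≤ a → Partition (a ∷ [])
  cons : ∀ {a b xs} → b ≤ a → Partition (b ∷ xs) → Partition (a ∷ b ∷ xs)

size : List ℕ → ℕ
size = sum

-- polynomials in ℚ[x] as coefficient lists (constant term first)
evalPoly : List ℚ → ℚ → ℚ
evalPoly []       x = 0ℚ
evalPoly (c ∷ cs) x = c Data.Rational.+ x Data.Rational.* evalPoly cs x
  where import Data.Rational

toℚ : ℕ → ℚ
toℚ n = (+ n) / 1

padOnes : List ℕ → ℕ → List ℕ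
padOnes μ n = μ ++ replicate (n ∸ size μ) 1

-- subscript (n-λ₁,…,n-λ_k, n,…,n) with r entries (valid when λ_i ≤ n)
subscript : ℕ → List ℕ → ℕ → List ℕ
subscript r λs n = map (λ a → n ∸ a) λs ++ replicate (r ∸ length λs) n

-- Let ℓ = (λ₁, …, λ_k, 0, …, 0) list the r cycle deficits and call a tuple (α, α₁, …, α_r) of
-- permutations of N points good when α₁ ⋯ α_r α = e, αᵢ has N − ℓᵢ cycles and α has cycle type
-- μ ∪ 1^{N − |μ|}; phrased suitably, goodness is preserved when a common fixed point is adjoined.
-- Let F(N, K) count the good tuples in which each of the points 0, …, K − 1 is moved by some factor.
-- Splitting on whether point K is moved, and deleting it when every factor fixes it, gives
-- F(N + 1, K) = F(N, K) + F(N + 1, K + 1). A permutation with c cycles moves at most 2 (N − c)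
-- points, so a good tuple moves at most M = |μ| + 2 |λ| points and F(N, N) = 0 for N > M.
-- Hence h(k, n) = F(k + n, k) obeys Pascal's rule, and Newton's formula gives
-- F(n, 0) = Σ_{j ≤ M} C(n, j) · F(j, j), a polynomial in n.

module Submission where

open import Defs
open import Level using (0ℓ)
open import Data.Nat as ℕ using (ℕ; zero; suc; _+_; _*_; _∸_; _≤_; _<_; _≥_; z≤n; s≤s; _≡ᵇ_; _≤ᵇ_; _<ᵇ_; _!)
open import Data.Nat.Properties using (module ≤-Reasoning; ≤-refl; ≤-reflexive; ≤-trans; ≤-antisym; ≤-pred; <⇒≤; <⇒≱; ≮⇒≥; ≰⇒>; <-irrefl; ≤-<-trans; _≤?_; _<?_; n≤1+n; n<1+n; m≤n⇒m≤1+n; m≤m+n; m≤n+m; suc-injective; ≡ᵇ⇒≡; ≡⇒≡ᵇ; ≤ᵇ⇒≤; ≤⇒≤ᵇ; <⇒<ᵇ; <ᵇ⇒<; +-comm; +-assoc; +-suc; +-identityʳ; +-mono-≤; +-monoˡ-≤; +-monoʳ-≤; +-cancelˡ-≤; *-zeroʳ; *-identityˡ; *-assoc; *-distribˡ-+; *-distribʳ-+; *-monoʳ-≤; *-distribˡ-∸; m∸n≤m; m<n⇒0<n∸m; m+[n∸m]≡n; m∸n+n≡m; m+n∸n≡m; m+n∸m≡n; +-∸-assoc; m+n≤o⇒m≤o∸n; m≤n⇒m∸n≡0; 0∸n≡0; _!≢0)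
open import Data.Nat.DivMod using (_%_; _/_; m≡m%n+[m/n]*n; m%n<n)
open import Data.Nat.ListAction using (sum)
open import Data.Nat.ListAction.Properties using (sum-++)
open import Data.Nat.Combinatorics using (_C_; nCk+nC[k+1]≡[n+1]C[k+1])
open import Data.Nat.Combinatorics.Base using (_P′_)
open import Data.Nat.Tactic.RingSolver using (solve-∀)
import Data.Nat.Coprimality as Coprime
import Data.Integer as ℤ
import Data.Integer.Properties as ℤₚ
open import Data.Rational as ℚ using (ℚ)
import Data.Rational.Properties as ℚₚ
import Tactic.RingSolver as RingSolver
import Tactic.RingSolver.Core.AlmostCommutativeRing as ACR
open import Data.Bool using (Bool; true; false; T; not; _∧_; _∨_; if_then_else_)
open import Data.Bool.Properties using (T-∧; T-≡; ∧-comm; ∧-assoc; ∧-identityʳ)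
open import Data.Empty using (⊥-elim)
open import Data.Sum using (_⊎_; inj₁; inj₂)
open import Data.Product using (Σ; ∃; _×_; _,_; proj₁; proj₂; uncurry)
open import Data.Fin using (Fin; zero; suc; toℕ; punchIn; punchOut; fromℕ<; _≟_) renaming (_≤_ to _≤ᶠ_)
open import Data.Fin.Properties using (pigeonhole; toℕ<n; toℕ-injective; toℕ-fromℕ<; punchIn-injective; punchInᵢ≢i; punchOut-cong; punchOut-punchIn; punchIn-punchOut; punchIn-mono-≤; punchIn-cancel-≤)
open import Data.List using (List; []; _∷_; _++_; map; concatMap; filter; length; replicate; tabulate; upTo; allFin; cartesianProductWith)
open import Data.Bool.ListAction using (all; and)
open import Data.List.Properties using (length-map; length-++; map-cong; map-∘; map-++; map-replicate; upTo-∷ʳ; filter-≐; filter-++; filter-none)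
open import Data.List.Relation.Unary.All as All using (All; []; _∷_; lookupAny)
open import Data.List.Relation.Unary.All.Properties using (all⁺; all⁻; all-filter; map⁺; concat⁺; applyUpTo⁺₁)
open import Data.List.Relation.Unary.Any as Any using (Any; here; there)
open import Data.List.Relation.Unary.AllPairs using ([]; _∷_)
open import Data.List.Relation.Binary.Pointwise using (Pointwise; []; _∷_; Pointwise-length)
import Data.List.Relation.Binary.Pointwise as Pointwiseₚ
import Data.List.Relation.Binary.Equality.Setoid as ListEquality
import Data.List.Relation.Binary.Subset.Setoid as SubsetSetoid
import Data.List.Relation.Unary.Unique.Setoid as UniqueSetoid
import Data.List.Relation.Unary.Unique.Setoid.Properties as Uniqueₚ
open import Data.List.Relation.Unary.Unique.Propositional.Properties using (allFin⁺)
import Data.List.Relation.Unary.Unique.Propositional.Properties as Uniqueₚ≡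
import Data.List.Membership.Setoid as MembershipSetoid
import Data.List.Membership.Setoid.Properties as Membershipₚ
open import Data.List.Membership.Propositional.Properties using (∈-allFin; ∈-upTo⁺; ∈-map⁺; ∈-map⁻; ∈-filter⁺; ∈-filter⁻)
import Data.List.Fresh as List#
import Data.List.Fresh.Relation.Unary.Any as Any#
import Data.List.Fresh.Membership.Setoid as Membership#
import Data.List.Fresh.Membership.Setoid.Properties as Membership#ₚ
open import Function using (_∘_; id; case_of_; _⇔_; mk⇔; Equivalence)
open import Function.Construct.Composition using (_⇔-∘_)
open import Function.Construct.Symmetry using (⇔-sym)
open import Function.Definitions using (Injective)
open import Relation.Binary.Bundles using (Setoid)
open import Relation.Binary.PropositionalEquality using (_≡_; _≢_; _≗_; refl; sym; trans; cong; cong₂; subst; subst₂; setoid; _→-setoid_; module ≡-Reasoning)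
open import Relation.Nullary.Decidable using (T?; yes; no; toWitness; fromWitness; dec⇒maybe)
open import Relation.Nullary.Negation using (¬_)

T-injective : ∀ {x y} → (T x ⇔ T y) → x ≡ y
T-injective {false} {false} _   = refl
T-injective {false} {true}  x⇔y = ⊥-elim (Equivalence.from x⇔y _)
T-injective {true}  {false} x⇔y = ⊥-elim (Equivalence.to x⇔y _)
T-injective {true}  {true}  _   = refl

T-not⇒¬T : ∀ {x} → T (not x) → ¬ T x
T-not⇒¬T {false} _ ()

¬T⇒T-not : ∀ {x} → ¬ T x → T (not x)
¬T⇒T-not {false} _  = _
¬T⇒T-not {true}  ¬t = ¬t _

T-not-∨ : ∀ {x y} → T (not x ∨ y) ⇔ (T x → T y)
T-not-∨ {false} = mk⇔ (λ _ ()) (λ _ → _)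
T-not-∨ {true}  = mk⇔ (λ y _ → y) (λ f → f _)

T-eqFin : ∀ {n} {i j : Fin n} → T (eqFin i j) ⇔ i ≡ j
T-eqFin = mk⇔ toWitness fromWitness

module _ {A : Set} where

  filter-≗ : ∀ {P Q : A → Bool} → P ≗ Q → ∀ xs → filter (T? ∘ P) xs ≡ filter (T? ∘ Q) xs
  filter-≗ {P} {Q} P≗Q = filter-≐ (T? ∘ P) (T? ∘ Q) ((λ {x} → subst T (P≗Q x)) , (λ {x} → subst T (sym (P≗Q x))))

  length-filter-split : ∀ (P Q : A → Bool) xs → length (filter (T? ∘ P) xs) ≡
    length (filter (T? ∘ λ x → P x ∧ Q x) xs) + length (filter (T? ∘ λ x → P x ∧ not (Q x)) xs)
  length-filter-split P Q []       = refl
  length-filter-split P Q (x ∷ xs) with P x | Q x | length-filter-split P Q xs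
  ... | false | _     | ih = ih
  ... | true  | true  | ih = cong suc ih
  ... | true  | false | ih = trans (cong suc ih) (sym (+-suc _ _))

T-all-allFin : ∀ {N} {P : Fin N → Bool} → T (all P (allFin N)) ⇔ (∀ i → T (P i))
T-all-allFin {N} {P} = mk⇔ (λ t i → All.lookup (all⁺ P (allFin N) t) (∈-allFin i))
                       (λ f → all⁻ P {allFin N} (All.tabulate (λ {i} _ → f i)))

T-all-upTo : ∀ {n} {P : ℕ → Bool} → T (all P (upTo n)) ⇔ (∀ m → m < n → T (P m))
T-all-upTo {n} {P} = mk⇔ (λ t m m<n → All.lookup (all⁺ P (upTo n) t) (∈-upTo⁺ m<n))
                         (λ f → all⁻ P (applyUpTo⁺₁ id n (f _)))

count : ∀ {N} → (Fin N → Bool) → ℕ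
count {zero}  P = 0
count {suc N} P = (if P zero then 1 else 0) + count (P ∘ suc)

count-cong : ∀ {N} {P Q : Fin N → Bool} → P ≗ Q → count P ≡ count Q
count-cong {zero}  P≗Q = refl
count-cong {suc N} P≗Q = cong₂ (λ b c → (if b then 1 else 0) + c) (P≗Q zero) (count-cong (P≗Q ∘ suc))

length-filter-tabulate : ∀ {A : Set} {N} (P : A → Bool) (f : Fin N → A) →
  length (filter (T? ∘ P) (tabulate f)) ≡ count (P ∘ f)
length-filter-tabulate {N = zero}  P f = refl
length-filter-tabulate {N = suc N} P f with P (f zero)
... | true  = cong suc (length-filter-tabulate P (f ∘ suc))
... | false = length-filter-tabulate P (f ∘ suc)

length-filter-allFin : ∀ {N} (P : Fin N → Bool) → length (filter (T? ∘ P) (allFin N)) ≡ count P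
length-filter-allFin P = length-filter-tabulate P id

count-punchIn : ∀ {N} (k : Fin (suc N)) (P : Fin (suc N) → Bool) →
  count P ≡ (if P k then 1 else 0) + count (P ∘ punchIn k)
count-punchIn zero    P = refl
count-punchIn {suc N} (suc k) P with P zero | P (suc k) | count-punchIn k (P ∘ suc)
... | false | _     | ih = ih
... | true  | false | ih = cong suc ih
... | true  | true  | ih = cong suc ih

count-split : ∀ {N} (P Q : Fin N → Bool) →
  count P ≡ count (λ i → P i ∧ Q i) + count (λ i → P i ∧ not (Q i))
count-split {zero}  P Q = refl
count-split {suc N} P Q with P zero | Q zero | count-split (P ∘ suc) (Q ∘ suc)
... | false | _     | ih = ih
... | true  | true  | ih = cong suc ih
... | true  | false | ih = trans (cong suc ih) (sym (+-suc _ _))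

count-mono : ∀ {N} {P Q : Fin N → Bool} → (∀ i → T (P i) → T (Q i)) → count P ≤ count Q
count-mono {zero}          P⇒Q = z≤n
count-mono {suc N} {P} {Q} P⇒Q with P zero | Q zero | P⇒Q zero | count-mono {P = P ∘ suc} {Q ∘ suc} (P⇒Q ∘ suc)
... | false | false | _ | ih = ih
... | false | true  | _ | ih = m≤n⇒m≤1+n ih
... | true  | true  | _ | ih = s≤s ih
... | true  | false | f | ih = ⊥-elim (f _)

count-∨ : ∀ {N} (P Q : Fin N → Bool) → count (λ i → P i ∨ Q i) ≤ count P + count Q
count-∨ {zero}  P Q = z≤n
count-∨ {suc N} P Q with P zero | Q zero | count-∨ (P ∘ suc) (Q ∘ suc)
... | false | false | ih = ih
... | false | true  | ih = ≤-trans (s≤s ih) (≤-reflexive (sym (+-suc _ _)))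
... | true  | false | ih = s≤s ih
... | true  | true  | ih = s≤s (≤-trans ih (≤-trans (n≤1+n _) (≤-reflexive (sym (+-suc _ _)))))

count-complement : ∀ {N} (P : Fin N → Bool) → count P + count (not ∘ P) ≡ N
count-complement {zero}  P = refl
count-complement {suc N} P with P zero | count-complement (P ∘ suc)
... | true  | ih = cong suc ih
... | false | ih = trans (+-suc _ _) (cong suc ih)

count-all : ∀ {N} {P : Fin N → Bool} → (∀ i → T (P i)) → count P ≡ N
count-all {zero}      _  = refl
count-all {suc N} {P} all-P with P zero | all-P zero
... | true | _ = cong suc (count-all (all-P ∘ suc))

count-none : ∀ {N} {P : Fin N → Bool} → (∀ i → ¬ T (P i)) → count P ≡ 0
count-none {zero}      _   = refl
count-none {suc N} {P} no-P with P zero | no-P zero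
... | false | _   = count-none (no-P ∘ suc)
... | true  | ¬tt = ⊥-elim (¬tt _)

count-pos : ∀ {N} {P : Fin N → Bool} i → T (P i) → 1 ≤ count P
count-pos {suc N} {P} zero    Pi with P zero
... | true = s≤s z≤n
count-pos {suc N} {P} (suc i) Pi = ≤-trans (count-pos i Pi) (m≤n+m _ _)

module _ (S : Setoid 0ℓ 0ℓ) where
  open MembershipSetoid S using (_∈_)
  open SubsetSetoid S using (_⊆_)
  open UniqueSetoid S using (Unique)
  private
    _∈#_ = Membership#._∈_ S

  ∈-fromList⁺ : ∀ {x xs} (xs! : Unique xs) → x ∈ xs → x ∈# List#.fromList xs!
  ∈-fromList⁺ (_ ∷ _)   (here x≈y)  = Any#.here x≈y
  ∈-fromList⁺ (_ ∷ xs!) (there x∈xs) = Any#.there (∈-fromList⁺ xs! x∈xs)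

  ∈-fromList⁻ : ∀ {x xs} (xs! : Unique xs) → x ∈# List#.fromList xs! → x ∈ xs
  ∈-fromList⁻ (_ ∷ _)   (Any#.here x≈y)   = here x≈y
  ∈-fromList⁻ (_ ∷ xs!) (Any#.there x∈xs) = there (∈-fromList⁻ xs! x∈xs)

  length-fromList : ∀ {xs} (xs! : Unique xs) → List#.length (List#.fromList xs!) ≡ length xs
  length-fromList []        = refl
  length-fromList (_ ∷ xs!) = cong suc (length-fromList xs!)

  Unique-⊆⇒length≤ : ∀ {xs ys} → Unique xs → Unique ys → xs ⊆ ys → length xs ≤ length ys
  Unique-⊆⇒length≤ xs! ys! xs⊆ys = subst₂ _≤_ (length-fromList xs!) (length-fromList ys!)
    (Membership#ₚ.injection S id (∈-fromList⁺ ys! ∘ xs⊆ys ∘ ∈-fromList⁻ xs!))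

  Unique-⊆⊇⇒length≡ : ∀ {xs ys} → Unique xs → Unique ys → xs ⊆ ys → ys ⊆ xs → length xs ≡ length ys
  Unique-⊆⊇⇒length≡ xs! ys! xs⊆ys ys⊆xs =
    ≤-antisym (Unique-⊆⇒length≤ xs! ys! xs⊆ys) (Unique-⊆⇒length≤ ys! xs! ys⊆xs)

count-injection : ∀ {N} {P Q : Fin N → Bool} (g : Fin N → Fin N) → Injective _≡_ _≡_ g →
  (∀ i → T (P i) → T (Q (g i))) → count P ≤ count Q
count-injection {N} {P} {Q} g g-inj P⇒Q∘g = begin
  count P                     ≡⟨ sym (length-filter-allFin P) ⟩
  length Ps                   ≡⟨ sym (length-map g Ps) ⟩
  length (map g Ps)           ≤⟨ Unique-⊆⇒length≤ (setoid (Fin N)) gPs! Qs! gPs⊆Qs ⟩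
  length Qs                   ≡⟨ length-filter-allFin Q ⟩
  count Q                     ∎
  where
  open ≤-Reasoning
  open import Data.List.Membership.Propositional using (_∈_)
  Ps = filter (T? ∘ P) (allFin N)
  Qs = filter (T? ∘ Q) (allFin N)
  gPs! = Uniqueₚ≡.map⁺ g-inj (Uniqueₚ≡.filter⁺ (T? ∘ P) (allFin⁺ N))
  Qs! = Uniqueₚ≡.filter⁺ (T? ∘ Q) (allFin⁺ N)
  gPs⊆Qs : ∀ {j} → j ∈ map g Ps → j ∈ Qs
  gPs⊆Qs j∈gPs with ∈-map⁻ g j∈gPs
  ... | i , i∈Ps , refl =
    ∈-filter⁺ (T? ∘ Q) (∈-allFin (g i)) (P⇒Q∘g i (proj₂ (∈-filter⁻ (T? ∘ P) {xs = allFin N} i∈Ps)))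

module _ {A B C : Set} (f : A → B → C) where

  concatMap-map≡cartesianProductWith : ∀ xs ys →
    concatMap (λ x → map (f x) ys) xs ≡ cartesianProductWith f xs ys
  concatMap-map≡cartesianProductWith []       ys = refl
  concatMap-map≡cartesianProductWith (x ∷ xs) ys =
    cong (map (f x) ys ++_) (concatMap-map≡cartesianProductWith xs ys)

module _ (S₁ S₂ S₃ : Setoid 0ℓ 0ℓ) (f : Setoid.Carrier S₁ → Setoid.Carrier S₂ → Setoid.Carrier S₃) where
  open Setoid S₁ using () renaming (_≈_ to _≈₁_)
  open Setoid S₂ using () renaming (_≈_ to _≈₂_)
  open Setoid S₃ using () renaming (_≈_ to _≈₃_)
  open MembershipSetoid S₁ using () renaming (_∈_ to _∈₁_)
  open MembershipSetoid S₂ using () renaming (_∈_ to _∈₂_)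
  open MembershipSetoid S₃ using () renaming (_∈_ to _∈₃_)

  Unique-concatMap-map : (∀ {a a′ b b′} → f a b ≈₃ f a′ b′ → a ≈₁ a′ × b ≈₂ b′) →
    ∀ {xs ys} → UniqueSetoid.Unique S₁ xs → UniqueSetoid.Unique S₂ ys →
    UniqueSetoid.Unique S₃ (concatMap (λ x → map (f x) ys) xs)
  Unique-concatMap-map f-inj {xs} {ys} xs! ys! =
    subst (UniqueSetoid.Unique S₃) (sym (concatMap-map≡cartesianProductWith f xs ys))
          (Uniqueₚ.cartesianProductWith⁺ S₁ S₂ S₃ f f-inj xs! ys!)

  ∈-concatMap-map⁺ : (∀ {a a′ b b′} → a ≈₁ a′ → b ≈₂ b′ → f a b ≈₃ f a′ b′) →
    ∀ {a b xs ys} → a ∈₁ xs → b ∈₂ ys → f a b ∈₃ concatMap (λ x → map (f x) ys) xs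
  ∈-concatMap-map⁺ f-cong {xs = xs} {ys} a∈xs b∈ys =
    subst (f _ _ ∈₃_) (sym (concatMap-map≡cartesianProductWith f xs ys))
          (Membershipₚ.∈-cartesianProductWith⁺ S₁ S₂ S₃ f-cong a∈xs b∈ys)

FunSetoid : ℕ → ℕ → Setoid 0ℓ 0ℓ
FunSetoid n m = Fin n →-setoid Fin m

allFuns-unique : ∀ n m → UniqueSetoid.Unique (FunSetoid n m) (allFuns n m)
allFuns-unique zero    m = [] ∷ []
allFuns-unique (suc n) m = Unique-concatMap-map (FunSetoid n m) (setoid (Fin m)) (FunSetoid (suc n) m) _
  (λ f≗g → (f≗g ∘ suc) , f≗g zero) (allFuns-unique n m) (allFin⁺ m)

∈-allFuns : ∀ n m (f : Fin n → Fin m) → MembershipSetoid._∈_ (FunSetoid n m) f (allFuns n m)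
∈-allFuns zero    m f = here (λ ())
∈-allFuns (suc n) m f =
  Membershipₚ.∈-resp-≈ (FunSetoid (suc n) m) (λ { zero → refl ; (suc i) → refl })
    (∈-concatMap-map⁺ (FunSetoid n m) (setoid (Fin m)) (FunSetoid (suc n) m) _
      (λ { f≗g refl zero → refl ; f≗g refl (suc i) → f≗g i })
      (∈-allFuns n m (f ∘ suc)) (∈-allFin (f zero)))

T-isInjective : ∀ {n} {f : Fin n → Fin n} → T (isInjective f) ⇔ Injective _≡_ _≡_ f
T-isInjective {n} {f} = mk⇔ to from
  where
  to : T (isInjective f) → Injective _≡_ _≡_ f
  to t {i} {j} fi≡fj with f i ≟ f j | Equivalence.to T-all-allFin (Equivalence.to T-all-allFin t i) j
  ... | yes _    | i≟j = toWitness i≟j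
  ... | no fi≢fj | _   = ⊥-elim (fi≢fj fi≡fj)
  from : Injective _≡_ _≡_ f → T (isInjective f)
  from f-inj = Equivalence.from T-all-allFin λ i → Equivalence.from T-all-allFin λ j → pair i j
    where
    pair : ∀ i j → T (not (eqFin (f i) (f j)) ∨ eqFin i j)
    pair i j with f i ≟ f j
    ... | yes fi≡fj = fromWitness (f-inj fi≡fj)
    ... | no _      = _

Injective-resp-≗ : ∀ {n} {f g : Fin n → Fin n} → f ≗ g → Injective _≡_ _≡_ f → Injective _≡_ _≡_ g
Injective-resp-≗ f≗g f-inj {i} {j} gi≡gj = f-inj (trans (f≗g i) (trans gi≡gj (sym (f≗g j))))

Sym-unique : ∀ n → UniqueSetoid.Unique (FunSetoid n n) (Sym n)
Sym-unique n = Uniqueₚ.filter⁺ (FunSetoid n n) (T? ∘ isInjective) (allFuns-unique n n)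

∈-Sym⁺ : ∀ {n} {f : Fin n → Fin n} → Injective _≡_ _≡_ f → MembershipSetoid._∈_ (FunSetoid n n) f (Sym n)
∈-Sym⁺ {n} {f} f-inj =
  Membershipₚ.∈-filter⁺ (FunSetoid n n) (T? ∘ isInjective) resp (∈-allFuns n n f) (Equivalence.from T-isInjective f-inj)
  where
  resp : ∀ {g h} → g ≗ h → T (isInjective g) → T (isInjective h)
  resp g≗h = Equivalence.from T-isInjective ∘ Injective-resp-≗ g≗h ∘ Equivalence.to T-isInjective

Sym-injective : ∀ n → All (Injective _≡_ _≡_) (Sym n)
Sym-injective n = All.map (Equivalence.to T-isInjective) (all-filter (T? ∘ isInjective) (allFuns n n))

module _ (S : Setoid 0ℓ 0ℓ) where
  open ListEquality S using (≋-setoid)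
  open MembershipSetoid S using (_∈_)
  open MembershipSetoid ≋-setoid using () renaming (_∈_ to _∈≋_)

  tuples-unique : ∀ r {xs} → UniqueSetoid.Unique S xs → UniqueSetoid.Unique ≋-setoid (tuples r xs)
  tuples-unique zero    xs! = [] ∷ []
  tuples-unique (suc r) xs! = Unique-concatMap-map S ≋-setoid ≋-setoid _∷_
    (λ { (x≈y ∷ xs≋ys) → x≈y , xs≋ys }) xs! (tuples-unique r xs!)

  ∈-tuples⁺ : ∀ {r xs t} → length t ≡ r → All (_∈ xs) t → t ∈≋ tuples r xs
  ∈-tuples⁺ refl []            = here []
  ∈-tuples⁺ refl (x∈xs ∷ t∈xs) =
    ∈-concatMap-map⁺ S ≋-setoid ≋-setoid _∷_ _∷_ x∈xs (∈-tuples⁺ refl t∈xs)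

All-tuples : ∀ {A : Set} {P : A → Set} r {xs} → All P xs → All (λ t → length t ≡ r × All P t) (tuples r xs)
All-tuples zero    _   = (refl , []) ∷ []
All-tuples (suc r) pxs =
  concat⁺ (map⁺ (All.map (λ px → map⁺ (All.map (λ (len , pt) → cong suc len , px ∷ pt) (All-tuples r pxs))) pxs))

TupleSetoid : ℕ → Setoid 0ℓ 0ℓ
TupleSetoid N = ListEquality.≋-setoid (FunSetoid N N)

module _ {N : ℕ} (r : ℕ) where
  open MembershipSetoid (TupleSetoid N) using (_∈_)

  ∈-tuples-Sym⁻ : ∀ {σs} → σs ∈ tuples r (Sym N) → length σs ≡ r × All (Injective _≡_ _≡_) σs
  ∈-tuples-Sym⁻ σs∈ with lookupAny (All-tuples r (Sym-injective N)) σs∈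
  ... | (len , τs-inj) , σs≋τs = trans (Pointwise-length σs≋τs) len ,
                                 All-resp-Pointwise σs≋τs τs-inj
    where
    All-resp-Pointwise : ∀ {σs τs} → Pointwise _≗_ σs τs → All (Injective _≡_ _≡_) τs → All (Injective _≡_ _≡_) σs
    All-resp-Pointwise []            []               = []
    All-resp-Pointwise (σ≗τ ∷ σs≋τs) (τ-inj ∷ τs-inj) =
      Injective-resp-≗ (sym ∘ σ≗τ) τ-inj ∷ All-resp-Pointwise σs≋τs τs-inj

  ∈-tuples-Sym⁺ : ∀ {σs} → length σs ≡ r → All (Injective _≡_ _≡_) σs → σs ∈ tuples r (Sym N)
  ∈-tuples-Sym⁺ len σs-inj = ∈-tuples⁺ (FunSetoid N N) len (All.map ∈-Sym⁺ σs-inj)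

-- Orbits and cycles

module _ {N : ℕ} (σ : Fin N → Fin N) where

  iter-+ : ∀ a b i → iter σ (a + b) i ≡ iter σ a (iter σ b i)
  iter-+ zero    b i = refl
  iter-+ (suc a) b i = cong σ (iter-+ a b i)

  iter-shift : ∀ m i → iter σ m (σ i) ≡ iter σ (suc m) i
  iter-shift zero    i = refl
  iter-shift (suc m) i = cong σ (iter-shift m i)

  iter-fixed : ∀ {i} → σ i ≡ i → ∀ m → iter σ m i ≡ i
  iter-fixed σi≡i zero    = refl
  iter-fixed σi≡i (suc m) = trans (cong σ (iter-fixed σi≡i m)) σi≡i

  iter-* : ∀ {p i} → iter σ p i ≡ i → ∀ q → iter σ (q * p) i ≡ i
  iter-* σᵖi≡i zero    = refl
  iter-* {p} {i} σᵖi≡i (suc q) = begin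
    iter σ (p + q * p) i       ≡⟨ iter-+ p (q * p) i ⟩
    iter σ p (iter σ (q * p) i) ≡⟨ cong (iter σ p) (iter-* σᵖi≡i q) ⟩
    iter σ p i                 ≡⟨ σᵖi≡i ⟩
    i                          ∎
    where open ≡-Reasoning

  T-isOrbitMin-below : ∀ {i} → T (isOrbitMin σ i) ⇔ (∀ m → m < N → toℕ i ≤ toℕ (iter σ m i))
  T-isOrbitMin-below {i} = mk⇔ (λ t m m<N → ≤ᵇ⇒≤ _ _ (Equivalence.to (T-all-upTo {N} {P}) t m m<N))
                               (λ i≤ → Equivalence.from (T-all-upTo {N} {P}) (λ m m<N → ≤⇒≤ᵇ (i≤ m m<N)))
    where
    P : ℕ → Bool
    P m = toℕ i ≤ᵇ toℕ (iter σ m i)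

  module _ (σ-inj : Injective _≡_ _≡_ σ) where

    iter-injective : ∀ m → Injective _≡_ _≡_ (iter σ m)
    iter-injective zero    eq = eq
    iter-injective (suc m) eq = iter-injective m (σ-inj eq)

    -- Pigeonhole on i, σ i, …, σᴺ i.
    period : ∀ i → ∃ λ p → p < N × iter σ (suc p) i ≡ i
    period i with pigeonhole (n<1+n N) (λ (a : Fin (suc N)) → iter σ (toℕ a) i)
    ... | a , b , a<b , σᵃi≡σᵇi = p , p<N , iter-injective (toℕ a) (begin
        iter σ (toℕ a) (iter σ (suc p) i) ≡⟨ iter-+ (toℕ a) (suc p) i ⟨
        iter σ (toℕ a + suc p) i           ≡⟨ cong (λ m → iter σ m i) a+[b∸a]≡b ⟩
        iter σ (toℕ b) i                   ≡⟨ σᵃi≡σᵇi ⟨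
        iter σ (toℕ a) i                   ∎)
      where
      open ≡-Reasoning
      p = toℕ b ∸ toℕ a ∸ 1
      b∸a≡1+p : toℕ b ∸ toℕ a ≡ suc p
      b∸a≡1+p = sym (m+[n∸m]≡n (m<n⇒0<n∸m a<b))
      a+[b∸a]≡b : toℕ a + suc p ≡ toℕ b
      a+[b∸a]≡b = trans (cong (toℕ a +_) (sym b∸a≡1+p)) (m+[n∸m]≡n (<⇒≤ a<b))
      p<N : p < N
      p<N = ≤-trans (subst (_≤ toℕ b) b∸a≡1+p (m∸n≤m (toℕ b) (toℕ a))) (≤-pred (toℕ<n b))

    iter-reduce : ∀ i m → ∃ λ m′ → m′ < N × iter σ m i ≡ iter σ m′ i
    iter-reduce i m with period i
    ... | p , p<N , σᵖ⁺¹i≡i = m % suc p , ≤-trans (m%n<n m (suc p)) p<N , (begin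
      iter σ m i                                    ≡⟨ cong (λ n → iter σ n i) (m≡m%n+[m/n]*n m (suc p)) ⟩
      iter σ (m % suc p + (m / suc p) * suc p) i    ≡⟨ iter-+ (m % suc p) _ i ⟩
      iter σ (m % suc p) (iter σ ((m / suc p) * suc p) i) ≡⟨ cong (iter σ (m % suc p)) (iter-* σᵖ⁺¹i≡i (m / suc p)) ⟩
      iter σ (m % suc p) i                          ∎)
      where open ≡-Reasoning

    T-isOrbitMin : ∀ {i} → T (isOrbitMin σ i) ⇔ (∀ m → toℕ i ≤ toℕ (iter σ m i))
    T-isOrbitMin {i} = mk⇔ to (λ i≤ → Equivalence.from T-isOrbitMin-below (λ m _ → i≤ m))
      where
      to : T (isOrbitMin σ i) → ∀ m → toℕ i ≤ toℕ (iter σ m i)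
      to t m with iter-reduce i m
      ... | m′ , m′<N , σᵐi≡σᵐ′i =
        subst (i ≤ᶠ_) (sym σᵐi≡σᵐ′i) (Equivalence.to T-isOrbitMin-below t m′ m′<N)

  isOrbitMin-fixed : ∀ {i} → σ i ≡ i → T (isOrbitMin σ i)
  isOrbitMin-fixed {i} σi≡i = Equivalence.from T-isOrbitMin-below
    (λ m _ → subst (i ≤ᶠ_) (sym (iter-fixed σi≡i m)) ≤-refl)

firstHit : (ℕ → Bool) → List ℕ → ℕ
firstHit h []       = 0
firstHit h (m ∷ ms) = if h m then m else firstHit h ms

firstHit-unique : ∀ {h} (F : List ℕ → ℕ) → F [] ≡ 0 → (∀ m ms → F (m ∷ ms) ≡ (if h m then m else F ms)) →
  ∀ xs → F xs ≡ firstHit h xs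
firstHit-unique     F F[] F∷ []       = F[]
firstHit-unique {h} F F[] F∷ (m ∷ ms) = trans (F∷ m ms) (cong (if h m then m else_) (firstHit-unique F F[] F∷ ms))

module _ {h : ℕ → Bool} where

  firstHit-++ : ∀ {xs} ys → Any (T ∘ h) xs → firstHit h (xs ++ ys) ≡ firstHit h xs
  firstHit-++ {m ∷ _}  ys (here hm) with h m
  ... | true = refl
  firstHit-++ {m ∷ xs} ys (there hit) with h m
  ... | true  = refl
  ... | false = firstHit-++ ys hit

  T-firstHit : ∀ xs → firstHit h xs ≢ 0 → T (h (firstHit h xs))
  T-firstHit []       0≢0 = ⊥-elim (0≢0 refl)
  T-firstHit (m ∷ ms) hit≢0 with h m in hm
  ... | true  = subst T (sym hm) _
  ... | false = T-firstHit ms hit≢0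

  All-firstHit : ∀ {P : ℕ → Set} {xs} → P 0 → All P xs → P (firstHit h xs)
  All-firstHit         P0 []              = P0
  All-firstHit {xs = m ∷ _} P0 (Pm ∷ Pms) with h m
  ... | true  = Pm
  ... | false = All-firstHit P0 Pms

firstHit-cong : ∀ {h h′} → h ≗ h′ → ∀ xs → firstHit h xs ≡ firstHit h′ xs
firstHit-cong h≗h′ []       = refl
firstHit-cong h≗h′ (m ∷ ms) =
  cong₂ (λ b n → if b then m else n) (h≗h′ m) (firstHit-cong h≗h′ ms)

returnsTo : ∀ {N} → (Fin N → Fin N) → Fin N → ℕ → Bool
returnsTo σ i m = eqFin (iter σ m i) i

oneTo : ℕ → List ℕ
oneTo N = map ℕ.suc (upTo N)

oneTo-suc : ∀ N → oneTo (suc N) ≡ oneTo N ++ suc N ∷ []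
oneTo-suc N = trans (cong (map ℕ.suc) (sym (upTo-∷ʳ N))) (map-++ ℕ.suc (upTo N) (N ∷ []))

-- `cycleLen` searches with a local helper that cannot be named, so it is recovered as the `F` of `firstHit-unique`.
cycleLen≡firstHit : ∀ {N} (σ : Fin N → Fin N) i → cycleLen σ i ≡ firstHit (returnsTo σ i) (oneTo N)
cycleLen≡firstHit {N} σ i with map ℕ.suc (upTo N) | firstHit-unique _ refl (λ _ _ → refl)
... | ms | helper≡firstHit = helper≡firstHit ms

module _ {N : ℕ} (σ : Fin N → Fin N) where

  fixes : Fin N → Bool
  fixes i = eqFin (σ i) i

  moves : Fin N → Bool
  moves i = not (fixes i)

  cycleLen≡1⇒fixed : ∀ {i} → cycleLen σ i ≡ 1 → σ i ≡ i
  cycleLen≡1⇒fixed {i} len≡1 = Equivalence.to T-eqFin (subst (T ∘ returnsTo σ i) hit≡1 returns-at-hit)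
    where
    hit≡1 = trans (sym (cycleLen≡firstHit σ i)) len≡1
    returns-at-hit = T-firstHit {returnsTo σ i} (oneTo N) (λ hit≡0 → case trans (sym hit≡1) hit≡0 of λ ())

  cycleLen≤ : ∀ i → cycleLen σ i ≤ N
  cycleLen≤ i = subst (_≤ N) (sym (cycleLen≡firstHit σ i))
    (All-firstHit {returnsTo σ i} {_≤ N} z≤n (map⁺ (applyUpTo⁺₁ id N id)))

cycleLen-fixed : ∀ {N} (σ : Fin N → Fin N) {i} → σ i ≡ i → cycleLen σ i ≡ 1
cycleLen-fixed {suc N} σ {i} σi≡i = trans (cycleLen≡firstHit σ i) (if-true (Equivalence.from T-eqFin σi≡i))
  where
  if-true : ∀ {b} {m : ℕ} → T b → (if b then 1 else m) ≡ 1
  if-true {true} _ = refl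

hasCycleLen : ∀ {N} → (Fin N → Fin N) → ℕ → Fin N → Bool
hasCycleLen σ j i = isOrbitMin σ i ∧ (cycleLen σ i ≡ᵇ j)

numCycles≡count : ∀ {N} (σ : Fin N → Fin N) → numCycles σ ≡ count (isOrbitMin σ)
numCycles≡count σ = length-filter-allFin (isOrbitMin σ)

numCyclesOfLen≡count : ∀ {N} (σ : Fin N → Fin N) j → numCyclesOfLen σ j ≡ count (hasCycleLen σ j)
numCyclesOfLen≡count σ j = length-filter-allFin (hasCycleLen σ j)

module _ {N : ℕ} {σ τ : Fin N → Fin N} (σ≗τ : σ ≗ τ) where

  iter-cong : ∀ m i → iter σ m i ≡ iter τ m i
  iter-cong zero    i = refl
  iter-cong (suc m) i = trans (σ≗τ (iter σ m i)) (cong τ (iter-cong m i))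

  isOrbitMin-cong : ∀ i → isOrbitMin σ i ≡ isOrbitMin τ i
  isOrbitMin-cong i = cong and (map-cong (λ m → cong (λ j → toℕ i ≤ᵇ toℕ j) (iter-cong m i)) (upTo N))

  cycleLen-cong : ∀ i → cycleLen σ i ≡ cycleLen τ i
  cycleLen-cong i = begin
    cycleLen σ i                        ≡⟨ cycleLen≡firstHit σ i ⟩
    firstHit (returnsTo σ i) (oneTo N)  ≡⟨ firstHit-cong (λ m → cong (λ j → eqFin j i) (iter-cong m i)) (oneTo N) ⟩
    firstHit (returnsTo τ i) (oneTo N)  ≡⟨ cycleLen≡firstHit τ i ⟨
    cycleLen τ i                        ∎
    where open ≡-Reasoning

  hasCycleLen-cong : ∀ j i → hasCycleLen σ j i ≡ hasCycleLen τ j i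
  hasCycleLen-cong j i = cong₂ (λ b c → b ∧ (c ≡ᵇ j)) (isOrbitMin-cong i) (cycleLen-cong i)

  numCycles-cong : numCycles σ ≡ numCycles τ
  numCycles-cong = trans (numCycles≡count σ) (trans (count-cong isOrbitMin-cong) (sym (numCycles≡count τ)))

  numCyclesOfLen-cong : ∀ j → numCyclesOfLen σ j ≡ numCyclesOfLen τ j
  numCyclesOfLen-cong j =
    trans (numCyclesOfLen≡count σ j) (trans (count-cong (hasCycleLen-cong j)) (sym (numCyclesOfLen≡count τ j)))

module _ {N : ℕ} (σ : Fin N → Fin N) where

  numCyclesOfLen-1 : numCyclesOfLen σ 1 ≡ count (fixes σ)
  numCyclesOfLen-1 = trans (numCyclesOfLen≡count σ 1) (count-cong λ i → T-injective (mk⇔ (to i) (from i)))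
    where
    to : ∀ i → T (hasCycleLen σ 1 i) → T (fixes σ i)
    to i t = Equivalence.from T-eqFin (cycleLen≡1⇒fixed σ (≡ᵇ⇒≡ _ 1 (proj₂ (Equivalence.to T-∧ t))))
    from : ∀ i → T (fixes σ i) → T (hasCycleLen σ 1 i)
    from i t = Equivalence.from T-∧ (isOrbitMin-fixed σ σi≡i , ≡⇒≡ᵇ _ 1 (cycleLen-fixed σ σi≡i))
      where σi≡i = Equivalence.to T-eqFin t

  numCyclesOfLen-> : ∀ {j} → N < j → numCyclesOfLen σ j ≡ 0
  numCyclesOfLen-> {j} N<j = trans (numCyclesOfLen≡count σ j) (count-none λ i t →
    <⇒≱ N<j (subst (_≤ N) (≡ᵇ⇒≡ _ j (proj₂ (Equivalence.to T-∧ t))) (cycleLen≤ σ i)))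

numCycles-pos : ∀ {N} (σ : Fin (suc N) → Fin (suc N)) → 1 ≤ numCycles σ
numCycles-pos σ = subst (1 ≤_) (sym (numCycles≡count σ))
  (count-pos {P = isOrbitMin σ} zero (Equivalence.from (T-isOrbitMin-below σ) (λ _ _ → z≤n)))

-- Adjoining a fixed point

module _ {N : ℕ} (k : Fin (suc N)) where

  addFixed : (Fin N → Fin N) → Fin (suc N) → Fin (suc N)
  addFixed σ x with k ≟ x
  ... | yes _   = k
  ... | no k≢x = punchIn k (σ (punchOut k≢x))

  addFixed-fixes : ∀ σ → addFixed σ k ≡ k
  addFixed-fixes σ with k ≟ k
  ... | yes _  = refl
  ... | no k≢k = ⊥-elim (k≢k refl)

  addFixed-punchIn : ∀ σ y → addFixed σ (punchIn k y) ≡ punchIn k (σ y)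
  addFixed-punchIn σ y with k ≟ punchIn k y
  ... | yes k≡k↑y = ⊥-elim (punchInᵢ≢i k y (sym k≡k↑y))
  ... | no k≢k↑y  = cong (punchIn k ∘ σ) (trans (punchOut-cong k refl) (punchOut-punchIn k))

  k-or-punchIn : ∀ x → x ≡ k ⊎ ∃ λ y → x ≡ punchIn k y
  k-or-punchIn x with k ≟ x
  ... | yes k≡x = inj₁ (sym k≡x)
  ... | no k≢x  = inj₂ (punchOut k≢x , sym (punchIn-punchOut k≢x))

  ≗-byCases : ∀ {A : Set} {f g : Fin (suc N) → A} → f k ≡ g k → (∀ y → f (punchIn k y) ≡ g (punchIn k y)) → f ≗ g
  ≗-byCases fk≡gk _     x with k-or-punchIn x
  ... | inj₁ refl       = fk≡gk
  ≗-byCases _     f↑≡g↑ x | inj₂ (y , refl) = f↑≡g↑ y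

  module _ {σ τ : Fin N → Fin N} where

    addFixed-cong : σ ≗ τ → addFixed σ ≗ addFixed τ
    addFixed-cong σ≗τ = ≗-byCases (trans (addFixed-fixes σ) (sym (addFixed-fixes τ)))
      (λ y → trans (addFixed-punchIn σ y) (trans (cong (punchIn k) (σ≗τ y)) (sym (addFixed-punchIn τ y))))

    addFixed-cancel : addFixed σ ≗ addFixed τ → σ ≗ τ
    addFixed-cancel eq y = punchIn-injective k _ _
      (trans (sym (addFixed-punchIn σ y)) (trans (eq (punchIn k y)) (addFixed-punchIn τ y)))

    addFixed-∘ : addFixed (σ ∘ τ) ≗ addFixed σ ∘ addFixed τ
    addFixed-∘ = ≗-byCases
      (trans (addFixed-fixes (σ ∘ τ)) (sym (trans (cong (addFixed σ) (addFixed-fixes τ)) (addFixed-fixes σ))))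
      (λ y → trans (addFixed-punchIn (σ ∘ τ) y)
               (sym (trans (cong (addFixed σ) (addFixed-punchIn τ y)) (addFixed-punchIn σ (τ y)))))

  addFixed-id : addFixed id ≗ id
  addFixed-id = ≗-byCases (addFixed-fixes id) (addFixed-punchIn id)

  addFixed-≗id : ∀ {σ} → addFixed σ ≗ id ⇔ σ ≗ id
  addFixed-≗id {σ} = mk⇔ (λ eq → addFixed-cancel (λ x → trans (eq x) (sym (addFixed-id x))))
                         (λ eq x → trans (addFixed-cong eq x) (addFixed-id x))

  prod-addFixed : ∀ σs → prod (map addFixed σs) ≗ addFixed (prod σs)
  prod-addFixed []       x = sym (addFixed-id x)
  prod-addFixed (σ ∷ σs) x = trans (cong (addFixed σ) (prod-addFixed σs x)) (sym (addFixed-∘ x))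

  addFixed-injective : ∀ {σ} → Injective _≡_ _≡_ σ → Injective _≡_ _≡_ (addFixed σ)
  addFixed-injective {σ} σ-inj {x} {x′} eq with k-or-punchIn x | k-or-punchIn x′
  ... | inj₁ refl       | inj₁ refl        = refl
  ... | inj₁ refl       | inj₂ (y′ , refl) =
    ⊥-elim (punchInᵢ≢i k (σ y′) (sym (trans (sym (addFixed-fixes σ)) (trans eq (addFixed-punchIn σ y′)))))
  ... | inj₂ (y , refl) | inj₁ refl        =
    ⊥-elim (punchInᵢ≢i k (σ y) (trans (sym (addFixed-punchIn σ y)) (trans eq (addFixed-fixes σ))))
  ... | inj₂ (y , refl) | inj₂ (y′ , refl) =
    cong (punchIn k) (σ-inj (punchIn-injective k _ _
      (trans (sym (addFixed-punchIn σ y)) (trans eq (addFixed-punchIn σ y′)))))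

  addFixed-surjective : ∀ {σ : Fin (suc N) → Fin (suc N)} → Injective _≡_ _≡_ σ → σ k ≡ k →
    ∃ λ τ → Injective _≡_ _≡_ τ × addFixed τ ≗ σ
  addFixed-surjective {σ} σ-inj σk≡k = τ , τ-inj , addFixed-τ
    where
    k≢σ↑ : ∀ y → k ≢ σ (punchIn k y)
    k≢σ↑ y k≡σ↑y = punchInᵢ≢i k y (σ-inj (trans (sym k≡σ↑y) (sym σk≡k)))
    τ : Fin N → Fin N
    τ y = punchOut (k≢σ↑ y)
    punchIn-τ : ∀ y → punchIn k (τ y) ≡ σ (punchIn k y)
    punchIn-τ y = punchIn-punchOut (k≢σ↑ y)
    τ-inj : Injective _≡_ _≡_ τ
    τ-inj {y} {y′} eq = punchIn-injective k y y′
      (σ-inj (trans (sym (punchIn-τ y)) (trans (cong (punchIn k) eq) (punchIn-τ y′))))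
    addFixed-τ : addFixed τ ≗ σ
    addFixed-τ = ≗-byCases (trans (addFixed-fixes τ) (sym σk≡k)) (λ y → trans (addFixed-punchIn τ y) (punchIn-τ y))

  eqFin-punchIn : ∀ a b → eqFin (punchIn k a) (punchIn k b) ≡ eqFin a b
  eqFin-punchIn a b = T-injective (mk⇔
    (Equivalence.from T-eqFin ∘ punchIn-injective k a b ∘ Equivalence.to T-eqFin)
    (Equivalence.from T-eqFin ∘ cong (punchIn k) ∘ Equivalence.to T-eqFin))

  iter-addFixed : ∀ σ m y → iter (addFixed σ) m (punchIn k y) ≡ punchIn k (iter σ m y)
  iter-addFixed σ zero    y = refl
  iter-addFixed σ (suc m) y = trans (cong (addFixed σ) (iter-addFixed σ m y)) (addFixed-punchIn σ (iter σ m y))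

  module _ {σ : Fin N → Fin N} (σ-inj : Injective _≡_ _≡_ σ) where

    isOrbitMin-addFixed : ∀ y → isOrbitMin (addFixed σ) (punchIn k y) ≡ isOrbitMin σ y
    isOrbitMin-addFixed y = T-injective (mk⇔
      (λ t → Equivalence.from min⇔ λ m → punchIn-cancel-≤ k y (iter σ m y)
        (subst (y⁺ ≤ᶠ_) (iter-addFixed σ m y) (Equivalence.to min⁺⇔ t m)))
      (λ t → Equivalence.from min⁺⇔ λ m →
        subst (y⁺ ≤ᶠ_) (sym (iter-addFixed σ m y)) (punchIn-mono-≤ k y (iter σ m y) (Equivalence.to min⇔ t m))))
      where
      y⁺ = punchIn k y
      min⇔ = T-isOrbitMin σ σ-inj
      min⁺⇔ = T-isOrbitMin (addFixed σ) (addFixed-injective σ-inj)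

    cycleLen-addFixed : ∀ y → cycleLen (addFixed σ) (punchIn k y) ≡ cycleLen σ y
    cycleLen-addFixed y = begin
      cycleLen (addFixed σ) (punchIn k y)        ≡⟨ cycleLen≡firstHit (addFixed σ) (punchIn k y) ⟩
      firstHit returns⁺ (oneTo (suc N))          ≡⟨ cong (firstHit returns⁺) (oneTo-suc N) ⟩
      firstHit returns⁺ (oneTo N ++ suc N ∷ [])  ≡⟨ firstHit-++ (suc N ∷ []) returns-within-N ⟩
      firstHit returns⁺ (oneTo N)                ≡⟨ firstHit-cong returns⁺≗returns (oneTo N) ⟩
      firstHit (returnsTo σ y) (oneTo N)         ≡⟨ cycleLen≡firstHit σ y ⟨
      cycleLen σ y                               ∎
      where
      open ≡-Reasoning
      returns⁺ = returnsTo (addFixed σ) (punchIn k y)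
      returns⁺≗returns : returns⁺ ≗ returnsTo σ y
      returns⁺≗returns m = trans (cong (λ x → eqFin x (punchIn k y)) (iter-addFixed σ m y)) (eqFin-punchIn (iter σ m y) y)
      returns-within-N : Any (T ∘ returns⁺) (oneTo N)
      returns-within-N with period σ σ-inj y
      ... | p , p<N , σᵖ⁺¹y≡y = Any.map
        (λ { refl → subst T (sym (returns⁺≗returns (suc p))) (Equivalence.from T-eqFin σᵖ⁺¹y≡y) })
        (∈-map⁺ ℕ.suc (∈-upTo⁺ p<N))

    hasCycleLen-addFixed : ∀ j y → hasCycleLen (addFixed σ) j (punchIn k y) ≡ hasCycleLen σ j y
    hasCycleLen-addFixed j y = cong₂ (λ b c → b ∧ (c ≡ᵇ j)) (isOrbitMin-addFixed y) (cycleLen-addFixed y)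

    numCycles-addFixed : numCycles (addFixed σ) ≡ suc (numCycles σ)
    numCycles-addFixed = begin
      numCycles (addFixed σ)                                 ≡⟨ numCycles≡count (addFixed σ) ⟩
      count (isOrbitMin (addFixed σ))                        ≡⟨ count-punchIn k (isOrbitMin (addFixed σ)) ⟩
      (if isOrbitMin (addFixed σ) k then 1 else 0) + count (isOrbitMin (addFixed σ) ∘ punchIn k)
        ≡⟨ cong₂ (λ b c → (if b then 1 else 0) + c) k-isOrbitMin (count-cong isOrbitMin-addFixed) ⟩
      suc (count (isOrbitMin σ))                             ≡⟨ cong suc (numCycles≡count σ) ⟨
      suc (numCycles σ)                                      ∎
      where
      open ≡-Reasoning
      k-isOrbitMin : isOrbitMin (addFixed σ) k ≡ true
      k-isOrbitMin = Equivalence.to T-≡ (isOrbitMin-fixed (addFixed σ) (addFixed-fixes σ))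

    numCyclesOfLen-addFixed : ∀ j → numCyclesOfLen (addFixed σ) j ≡ (if 1 ≡ᵇ j then 1 else 0) + numCyclesOfLen σ j
    numCyclesOfLen-addFixed j = begin
      numCyclesOfLen (addFixed σ) j                        ≡⟨ numCyclesOfLen≡count (addFixed σ) j ⟩
      count (hasCycleLen (addFixed σ) j)                   ≡⟨ count-punchIn k (hasCycleLen (addFixed σ) j) ⟩
      (if hasCycleLen (addFixed σ) j k then 1 else 0) + count (hasCycleLen (addFixed σ) j ∘ punchIn k)
        ≡⟨ cong₂ (λ b c → (if b then 1 else 0) + c) k-hasCycleLen (count-cong (hasCycleLen-addFixed j)) ⟩
      (if 1 ≡ᵇ j then 1 else 0) + count (hasCycleLen σ j)
        ≡⟨ cong ((if 1 ≡ᵇ j then 1 else 0) +_) (numCyclesOfLen≡count σ j) ⟨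
      (if 1 ≡ᵇ j then 1 else 0) + numCyclesOfLen σ j       ∎
      where
      open ≡-Reasoning
      k-hasCycleLen : hasCycleLen (addFixed σ) j k ≡ (1 ≡ᵇ j)
      k-hasCycleLen = cong₂ (λ b c → b ∧ (c ≡ᵇ j))
        (Equivalence.to T-≡ (isOrbitMin-fixed (addFixed σ) (addFixed-fixes σ)))
        (cycleLen-fixed (addFixed σ) (addFixed-fixes σ))

module _ {N : ℕ} {σ : Fin N → Fin N} (σ-inj : Injective _≡_ _≡_ σ) where

  image-of-moved-orbitMin : ∀ {i} → T (isOrbitMin σ i) → T (moves σ i) →
    T (moves σ (σ i) ∧ not (isOrbitMin σ (σ i)))
  image-of-moved-orbitMin {i} i-min i-moved =
    Equivalence.from T-∧ (¬T⇒T-not (σ-moved ∘ Equivalence.to T-eqFin) , ¬T⇒T-not σi-not-min)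
    where
    σi≢i : σ i ≢ i
    σi≢i = T-not⇒¬T i-moved ∘ Equivalence.from T-eqFin
    σ-moved : σ (σ i) ≢ σ i
    σ-moved = σi≢i ∘ σ-inj
    σi-not-min : ¬ T (isOrbitMin σ (σ i))
    σi-not-min σi-min with period σ σ-inj i
    ... | p , _ , σᵖ⁺¹i≡i = σi≢i (toℕ-injective (≤-antisym σi≤i i≤σi))
      where
      σi≤i = subst (σ i ≤ᶠ_) (trans (iter-shift σ p i) σᵖ⁺¹i≡i)
                   (Equivalence.to (T-isOrbitMin σ σ-inj) σi-min p)
      i≤σi = Equivalence.to (T-isOrbitMin σ σ-inj) i-min 1

  -- Every cycle of length ≥ 2 contains two moved points, its minimum and the image of its minimum.
  moves-bound : count (moves σ) ≤ 2 * (N ∸ numCycles σ)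
  moves-bound = begin
    Mv                ≤⟨ m+n≤o⇒m≤o∸n Mv Mv+2c≤2N ⟩
    2 * N ∸ 2 * c     ≡⟨ *-distribˡ-∸ 2 N c ⟨
    2 * (N ∸ c)       ∎
    where
    open ≤-Reasoning
    min = isOrbitMin σ
    c = numCycles σ
    F = count (fixes σ)
    Mv = count (moves σ)
    A = count (λ i → min i ∧ moves σ i)
    c≤F+A : c ≤ F + A
    c≤F+A = begin
      c                                    ≡⟨ numCycles≡count σ ⟩
      count min                            ≡⟨ count-split min (fixes σ) ⟩
      count (λ i → min i ∧ fixes σ i) + A
        ≤⟨ +-monoˡ-≤ A (count-mono {P = λ i → min i ∧ fixes σ i} (λ i → proj₂ ∘ Equivalence.to T-∧)) ⟩
      F + A                                ∎
    2A≤Mv : A + A ≤ Mv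
    2A≤Mv = begin
      A + A
        ≤⟨ +-mono-≤ (count-mono {P = λ i → min i ∧ moves σ i} (λ i → subst T (∧-comm (min i) (moves σ i))))
                    (count-injection σ σ-inj (λ i → uncurry image-of-moved-orbitMin ∘ Equivalence.to T-∧)) ⟩
      count (λ i → moves σ i ∧ min i) + count (λ i → moves σ i ∧ not (min i))
        ≡⟨ count-split (moves σ) min ⟨
      Mv                                   ∎
    Mv+2c≤2N : Mv + 2 * c ≤ 2 * N
    Mv+2c≤2N = begin
      Mv + 2 * c             ≤⟨ +-monoʳ-≤ Mv (*-monoʳ-≤ 2 c≤F+A) ⟩
      Mv + 2 * (F + A)       ≡⟨ regroup Mv F A ⟩
      2 * F + (Mv + (A + A)) ≤⟨ +-monoʳ-≤ (2 * F) (+-monoʳ-≤ Mv 2A≤Mv) ⟩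
      2 * F + (Mv + Mv)      ≡⟨ collect F Mv ⟩
      2 * (F + Mv)           ≡⟨ cong (2 *_) (count-complement (fixes σ)) ⟩
      2 * N                  ∎
      where
      regroup : ∀ m f a → m + 2 * (f + a) ≡ 2 * f + (m + (a + a))
      regroup = solve-∀
      collect : ∀ f m → 2 * f + (m + m) ≡ 2 * (f + m)
      collect = solve-∀

-- Cycle types, deficits and covering tuples

mult-++ : ∀ j xs ys → mult j (xs ++ ys) ≡ mult j xs + mult j ys
mult-++ j xs ys = trans (cong length (filter-++ (λ x → T? (x ≡ᵇ j)) xs ys)) (length-++ (filter (λ x → T? (x ≡ᵇ j)) xs))

mult-1-replicate : ∀ d → mult 1 (replicate d 1) ≡ d
mult-1-replicate zero    = refl
mult-1-replicate (suc d) = cong suc (mult-1-replicate d)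

mult-2+-replicate : ∀ j d → mult (2 + j) (replicate d 1) ≡ 0
mult-2+-replicate j zero    = refl
mult-2+-replicate j (suc d) = mult-2+-replicate j d

mult-> : ∀ {j} xs → size xs < j → mult j xs ≡ 0
mult-> []       _         = refl
mult-> {j} (x ∷ xs) Σxxs<j with x ≡ᵇ j in x≡ᵇj
... | true  = ⊥-elim (<⇒≱ (≤-<-trans (m≤m+n x (size xs)) Σxxs<j)
                          (≤-reflexive (sym (≡ᵇ⇒≡ x j (subst T (sym x≡ᵇj) _)))))
... | false = mult-> xs (≤-<-trans (m≤n+m (size xs) x) Σxxs<j)

T-hasCycleType : ∀ {N} (α : Fin N → Fin N) ν → size ν ≡ N →
  T (hasCycleType α ν) ⇔ (∀ j → numCyclesOfLen α (suc j) ≡ mult (suc j) ν)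
T-hasCycleType {N} α ν Σν≡N = mk⇔ to from
  where
  agrees : ℕ → Bool
  agrees j = numCyclesOfLen α j ≡ᵇ mult j ν
  all-shift : hasCycleType α ν ≡ all (agrees ∘ ℕ.suc) (upTo N)
  all-shift = cong and (sym (map-∘ {g = agrees} {f = ℕ.suc} (upTo N)))
  to : T (hasCycleType α ν) → ∀ j → numCyclesOfLen α (suc j) ≡ mult (suc j) ν
  to t j with j <? N
  ... | yes j<N = ≡ᵇ⇒≡ _ _ (Equivalence.to (T-all-upTo {N} {agrees ∘ ℕ.suc}) (subst T all-shift t) j j<N)
  ... | no  j≮N = trans (numCyclesOfLen-> α N<1+j) (sym (mult-> ν (subst (_< suc j) (sym Σν≡N) N<1+j)))
    where N<1+j = s≤s (≮⇒≥ j≮N)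
  from : (∀ j → numCyclesOfLen α (suc j) ≡ mult (suc j) ν) → T (hasCycleType α ν)
  from agree = subst T (sym all-shift) (Equivalence.from (T-all-upTo {N} {agrees ∘ ℕ.suc}) λ j _ → ≡⇒≡ᵇ _ _ (agree j))

size-padOnes : ∀ μ {N} → size μ ≤ N → size (padOnes μ N) ≡ N
size-padOnes μ {N} Σμ≤N = begin
  size (μ ++ replicate (N ∸ size μ) 1)        ≡⟨ sum-++ μ _ ⟩
  size μ + size (replicate (N ∸ size μ) 1)    ≡⟨ cong (size μ +_) (sum-replicate-1 (N ∸ size μ)) ⟩
  size μ + (N ∸ size μ)                       ≡⟨ m+[n∸m]≡n Σμ≤N ⟩
  N                                           ∎
  where
  open ≡-Reasoning
  sum-replicate-1 : ∀ d → size (replicate d 1) ≡ d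
  sum-replicate-1 zero    = refl
  sum-replicate-1 (suc d) = cong suc (sum-replicate-1 d)

-- α has cycle type μ ∪ 1^{N − |μ|}, stated without subtraction so that it is meaningful for every N
-- and unchanged by adjoining a fixed point.
module _ (μ : List ℕ) {N : ℕ} (α : Fin N → Fin N) where

  PaddedCycleType : Set
  PaddedCycleType = (numCyclesOfLen α 1 + size μ ≡ mult 1 μ + N) × (∀ j → numCyclesOfLen α (2 + j) ≡ mult (2 + j) μ)

  hasPaddedCycleType : Bool
  hasPaddedCycleType = (numCyclesOfLen α 1 + size μ ≡ᵇ mult 1 μ + N)
                     ∧ all (λ j → numCyclesOfLen α (2 + j) ≡ᵇ mult (2 + j) μ) (upTo (N + size μ))

  T-hasPaddedCycleType : T hasPaddedCycleType ⇔ PaddedCycleType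
  T-hasPaddedCycleType = mk⇔ to from
    where
    agrees : ℕ → Bool
    agrees j = numCyclesOfLen α (2 + j) ≡ᵇ mult (2 + j) μ
    to : T hasPaddedCycleType → PaddedCycleType
    to t with Equivalence.to T-∧ t
    ... | fixed-ok , longer-ok = ≡ᵇ⇒≡ _ _ fixed-ok , longer
      where
      longer : ∀ j → numCyclesOfLen α (2 + j) ≡ mult (2 + j) μ
      longer j with j <? N + size μ
      ... | yes j<N+Σμ = ≡ᵇ⇒≡ _ _ (Equivalence.to (T-all-upTo {N + size μ} {agrees}) longer-ok j j<N+Σμ)
      ... | no  j≮N+Σμ = trans (numCyclesOfLen-> α (bound (m≤m+n N (size μ)))) (sym (mult-> μ (bound (m≤n+m (size μ) N))))
        where
        bound : ∀ {m} → m ≤ N + size μ → m < 2 + j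
        bound m≤ = ≤-trans (s≤s m≤) (s≤s (≤-trans (≮⇒≥ j≮N+Σμ) (n≤1+n j)))
    from : PaddedCycleType → T hasPaddedCycleType
    from (fixed-ok , longer) = Equivalence.from T-∧
      (≡⇒≡ᵇ _ _ fixed-ok , Equivalence.from (T-all-upTo {N + size μ} {agrees}) (λ j _ → ≡⇒≡ᵇ _ _ (longer j)))

  hasCycleType-padOnes : size μ ≤ N → T (hasCycleType α (padOnes μ N)) ⇔ PaddedCycleType
  hasCycleType-padOnes Σμ≤N = mk⇔ to from
    where
    ν = padOnes μ N
    ones = replicate (N ∸ size μ) 1
    mult-1-ν : mult 1 ν ≡ mult 1 μ + (N ∸ size μ)
    mult-1-ν = trans (mult-++ 1 μ ones) (cong (mult 1 μ +_) (mult-1-replicate (N ∸ size μ)))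
    mult-2+-ν : ∀ j → mult (2 + j) ν ≡ mult (2 + j) μ
    mult-2+-ν j = trans (mult-++ (2 + j) μ ones)
      (trans (cong (mult (2 + j) μ +_) (mult-2+-replicate j (N ∸ size μ))) (+-identityʳ _))
    agree⇔ = T-hasCycleType α ν (size-padOnes μ Σμ≤N)
    to : T (hasCycleType α ν) → PaddedCycleType
    to t = fixed-ok , λ j → trans (agree (suc j)) (mult-2+-ν j)
      where
      agree = Equivalence.to agree⇔ t
      fixed-ok : numCyclesOfLen α 1 + size μ ≡ mult 1 μ + N
      fixed-ok = begin
        numCyclesOfLen α 1 + size μ            ≡⟨ cong (_+ size μ) (trans (agree 0) mult-1-ν) ⟩
        mult 1 μ + (N ∸ size μ) + size μ       ≡⟨ +-assoc (mult 1 μ) (N ∸ size μ) (size μ) ⟩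
        mult 1 μ + (N ∸ size μ + size μ)       ≡⟨ cong (mult 1 μ +_) (m∸n+n≡m Σμ≤N) ⟩
        mult 1 μ + N                           ∎
        where open ≡-Reasoning
    from : PaddedCycleType → T (hasCycleType α ν)
    from (fixed-ok , longer) = Equivalence.from agree⇔ λ
      { zero    → begin
          numCyclesOfLen α 1                   ≡⟨ m+n∸n≡m (numCyclesOfLen α 1) (size μ) ⟨
          numCyclesOfLen α 1 + size μ ∸ size μ ≡⟨ cong (_∸ size μ) fixed-ok ⟩
          mult 1 μ + N ∸ size μ                ≡⟨ +-∸-assoc (mult 1 μ) Σμ≤N ⟩
          mult 1 μ + (N ∸ size μ)              ≡⟨ mult-1-ν ⟨
          mult 1 ν                             ∎
      ; (suc j) → trans (longer j) (sym (mult-2+-ν j)) }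
      where open ≡-Reasoning

module _ (μ : List ℕ) {N : ℕ} where

  PaddedCycleType-addFixed : ∀ (k : Fin (suc N)) {α} → Injective _≡_ _≡_ α →
    PaddedCycleType μ (addFixed k α) ⇔ PaddedCycleType μ α
  PaddedCycleType-addFixed k {α} α-inj = mk⇔
    (λ (fixed-ok , longer) → suc-injective (trans (sym (cong (_+ size μ) (nc⁺ 1))) (trans fixed-ok (+-suc _ N))) ,
                             λ j → trans (sym (nc⁺ (2 + j))) (longer j))
    (λ (fixed-ok , longer) → trans (cong (_+ size μ) (nc⁺ 1)) (trans (cong suc fixed-ok) (sym (+-suc _ N))) ,
                             λ j → trans (nc⁺ (2 + j)) (longer j))
    where
    nc⁺ = numCyclesOfLen-addFixed k α-inj

  PaddedCycleType-cong : ∀ {α β : Fin N → Fin N} → α ≗ β → PaddedCycleType μ α → PaddedCycleType μ β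
  PaddedCycleType-cong α≗β (fixed-ok , longer) =
    trans (cong (_+ size μ) (sym (numCyclesOfLen-cong α≗β 1))) fixed-ok ,
    λ j → trans (sym (numCyclesOfLen-cong α≗β (2 + j))) (longer j)

  hasPaddedCycleType-cong : ∀ {α β : Fin N → Fin N} → α ≗ β → hasPaddedCycleType μ α ≡ hasPaddedCycleType μ β
  hasPaddedCycleType-cong {α} {β} α≗β = T-injective
    (⇔-sym (T-hasPaddedCycleType μ β) ⇔-∘ (mk⇔ (PaddedCycleType-cong α≗β) (PaddedCycleType-cong (sym ∘ α≗β))
                                          ⇔-∘ T-hasPaddedCycleType μ α))

  hasPaddedCycleType-addFixed : ∀ (k : Fin (suc N)) {α} → Injective _≡_ _≡_ α →
    hasPaddedCycleType μ (addFixed k α) ≡ hasPaddedCycleType μ α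
  hasPaddedCycleType-addFixed k {α} α-inj = T-injective
    (⇔-sym (T-hasPaddedCycleType μ α) ⇔-∘ (PaddedCycleType-addFixed k α-inj ⇔-∘ T-hasPaddedCycleType μ (addFixed k α)))

deficitsAre : ∀ {N} → List (Fin N → Fin N) → List ℕ → Bool
deficitsAre {N} (σ ∷ σs) (l ∷ ls) = (numCycles σ + l ≡ᵇ N) ∧ deficitsAre σs ls
deficitsAre     []       []       = true
deficitsAre     _        _        = false

deficitsAre-addFixed : ∀ {N} (k : Fin (suc N)) {σs} → All (Injective _≡_ _≡_) σs →
  ∀ ls → deficitsAre (map (addFixed k) σs) ls ≡ deficitsAre σs ls
deficitsAre-addFixed k []               []       = refl
deficitsAre-addFixed k []               (_ ∷ _)  = refl
deficitsAre-addFixed k (_ ∷ _)          []       = refl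
deficitsAre-addFixed k (σ-inj ∷ σs-inj) (l ∷ ls) =
  cong₂ (λ c b → (c + l ≡ᵇ _) ∧ b) (numCycles-addFixed k σ-inj) (deficitsAre-addFixed k σs-inj ls)

deficitsAre-cong : ∀ {N} {σs τs : List (Fin N → Fin N)} → Pointwise _≗_ σs τs → ∀ ls → deficitsAre σs ls ≡ deficitsAre τs ls
deficitsAre-cong []              []       = refl
deficitsAre-cong []              (_ ∷ _)  = refl
deficitsAre-cong (_ ∷ _)         []       = refl
deficitsAre-cong (σ≗τ ∷ σs≋τs) (l ∷ ls) =
  cong₂ (λ c b → (c + l ≡ᵇ _) ∧ b) (numCycles-cong σ≗τ) (deficitsAre-cong σs≋τs ls)

-- With at least one point every permutation has a cycle, so the truncated N ∸ l never matches spuriously.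
cycleCountsAre-complement : ∀ {N} (σs : List (Fin (suc N) → Fin (suc N))) ls →
  cycleCountsAre σs (map (suc N ∸_) ls) ≡ deficitsAre σs ls
cycleCountsAre-complement []       []       = refl
cycleCountsAre-complement []       (_ ∷ _)  = refl
cycleCountsAre-complement (_ ∷ _)  []       = refl
cycleCountsAre-complement {N} (σ ∷ σs) (l ∷ ls) = cong₂ _∧_ count-matches (cycleCountsAre-complement σs ls)
  where
  c = numCycles σ
  count-matches : (c ≡ᵇ suc N ∸ l) ≡ (c + l ≡ᵇ suc N)
  count-matches = T-injective (mk⇔ (≡⇒≡ᵇ _ _ ∘ to ∘ ≡ᵇ⇒≡ _ _) (≡⇒≡ᵇ _ _ ∘ from ∘ ≡ᵇ⇒≡ _ _))
    where
    to : c ≡ suc N ∸ l → c + l ≡ suc N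
    to c≡N∸l with l ≤? suc N
    ... | yes l≤N = trans (cong (_+ l) c≡N∸l) (m∸n+n≡m l≤N)
    ... | no  l≰N = ⊥-elim (<⇒≱ (numCycles-pos σ)
                              (≤-reflexive (trans c≡N∸l (m≤n⇒m∸n≡0 (≤-trans (n≤1+n _) (≰⇒> l≰N))))))
    from : c + l ≡ suc N → c ≡ suc N ∸ l
    from c+l≡N = trans (sym (m+n∸n≡m c l)) (cong (_∸ l) c+l≡N)

T-isId : ∀ {N} {f : Fin N → Fin N} → T (isId f) ⇔ f ≗ id
T-isId = mk⇔ (λ t i → Equivalence.to T-eqFin (Equivalence.to T-all-allFin t i))
             (λ f≗id → Equivalence.from T-all-allFin (λ i → Equivalence.from T-eqFin (f≗id i)))

isId-cong : ∀ {N} {f g : Fin N → Fin N} → f ≗ g → isId f ≡ isId g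
isId-cong f≗g = T-injective (mk⇔
  (λ t → Equivalence.from T-isId λ x → trans (sym (f≗g x)) (Equivalence.to T-isId t x))
  (λ t → Equivalence.from T-isId λ x → trans (f≗g x) (Equivalence.to T-isId t x)))

prod-cong : ∀ {N} {σs τs : List (Fin N → Fin N)} → Pointwise _≗_ σs τs → prod σs ≗ prod τs
prod-cong []                            i = refl
prod-cong {τs = τ ∷ _} (σ≗τ ∷ σs≋τs) i = trans (σ≗τ _) (cong τ (prod-cong σs≋τs i))

movedBySome : ∀ {N} → List (Fin N → Fin N) → Fin N → Bool
movedBySome []       p = false
movedBySome (σ ∷ σs) p = moves σ p ∨ movedBySome σs p

movedBySome-cong : ∀ {N} {σs τs : List (Fin N → Fin N)} → Pointwise _≗_ σs τs → ∀ p → movedBySome σs p ≡ movedBySome τs p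
movedBySome-cong []            p = refl
movedBySome-cong (σ≗τ ∷ σs≋τs) p = cong₂ (λ q b → not (eqFin q p) ∨ b) (σ≗τ p) (movedBySome-cong σs≋τs p)

module _ {N : ℕ} (k : Fin (suc N)) where

  movedBySome-addFixed-k : ∀ σs → movedBySome (map (addFixed k) σs) k ≡ false
  movedBySome-addFixed-k []       = refl
  movedBySome-addFixed-k (σ ∷ σs) = trans
    (cong₂ (λ q b → not (eqFin q k) ∨ b) (addFixed-fixes k σ) (movedBySome-addFixed-k σs))
    (cong (λ b → not b ∨ false) (Equivalence.to T-≡ (Equivalence.from T-eqFin refl)))

  movedBySome-addFixed-punchIn : ∀ σs y → movedBySome (map (addFixed k) σs) (punchIn k y) ≡ movedBySome σs y
  movedBySome-addFixed-punchIn []       y = refl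
  movedBySome-addFixed-punchIn (σ ∷ σs) y = cong₂ (λ b c → not b ∨ c)
    (trans (cong (λ q → eqFin q (punchIn k y)) (addFixed-punchIn k σ y)) (eqFin-punchIn k (σ y) y))
    (movedBySome-addFixed-punchIn σs y)

  isId-prod-addFixed : ∀ σs → isId (prod (map (addFixed k) σs)) ≡ isId (prod σs)
  isId-prod-addFixed σs = T-injective (mk⇔
    (λ t → Equivalence.from T-isId (Equivalence.to (addFixed-≗id k) λ x →
             trans (sym (prod-addFixed k σs x)) (Equivalence.to T-isId t x)))
    (λ t → Equivalence.from T-isId λ x →
             trans (prod-addFixed k σs x) (Equivalence.from (addFixed-≗id k) (Equivalence.to T-isId t) x)))

toℕ-punchIn-< : ∀ {N} (k : Fin (suc N)) y → toℕ y < toℕ k → toℕ (punchIn k y) ≡ toℕ y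
toℕ-punchIn-< (suc k) zero    _         = refl
toℕ-punchIn-< (suc k) (suc y) (s≤s y<k) = cong suc (toℕ-punchIn-< k y y<k)

toℕ-punchIn-≥ : ∀ {N} (k : Fin (suc N)) y → toℕ k ≤ toℕ y → toℕ (punchIn k y) ≡ suc (toℕ y)
toℕ-punchIn-≥ zero    y       _         = refl
toℕ-punchIn-≥ (suc k) (suc y) (s≤s k≤y) = cong suc (toℕ-punchIn-≥ k y k≤y)

covers : ∀ {N} → ℕ → List (Fin N → Fin N) → Bool
covers {N} K σs = all (λ p → not (toℕ p <ᵇ K) ∨ movedBySome σs p) (allFin N)

module _ {N : ℕ} (σs : List (Fin N → Fin N)) where

  T-covers : ∀ {K} → T (covers K σs) ⇔ (∀ p → toℕ p < K → T (movedBySome σs p))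
  T-covers {K} = mk⇔
    (λ t p p<K → Equivalence.to T-not-∨ (Equivalence.to T-all-allFin t p) (<⇒<ᵇ p<K))
    (λ f → Equivalence.from T-all-allFin λ p → Equivalence.from T-not-∨ (f p ∘ <ᵇ⇒< _ _))

  covers-zero : covers 0 σs ≡ true
  covers-zero = Equivalence.to T-≡ (Equivalence.from (T-covers {0}) λ _ ())

  covers-everything : T (covers N σs) → ∀ p → T (movedBySome σs p)
  covers-everything t p = Equivalence.to T-covers t p (toℕ<n p)

  covers-suc : ∀ k → covers (suc (toℕ k)) σs ≡ covers (toℕ k) σs ∧ movedBySome σs k
  covers-suc k = T-injective (mk⇔
    (λ t → Equivalence.from T-∧ (Equivalence.from T-covers (λ p p<k → Equivalence.to T-covers t p (m≤n⇒m≤1+n p<k)) ,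
                                 Equivalence.to T-covers t k ≤-refl))
    (λ t → let (below , at) = Equivalence.to T-∧ t in Equivalence.from T-covers λ p p≤k → case p p≤k below at))
    where
    case : ∀ p → toℕ p < suc (toℕ k) → T (covers (toℕ k) σs) → T (movedBySome σs k) → T (movedBySome σs p)
    case p p≤k below at with toℕ p <? toℕ k
    ... | yes p<k = Equivalence.to T-covers below p p<k
    ... | no  p≮k = subst (T ∘ movedBySome σs) (sym (toℕ-injective (≤-antisym (≤-pred p≤k) (≮⇒≥ p≮k)))) at

covers-cong : ∀ {N} {σs τs : List (Fin N → Fin N)} → Pointwise _≗_ σs τs → ∀ K → covers K σs ≡ covers K τs
covers-cong {N} σs≋τs K = cong and (map-cong (λ p → cong (not (toℕ p <ᵇ K) ∨_) (movedBySome-cong σs≋τs p)) (allFin N))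

covers-addFixed : ∀ {N} (k : Fin (suc N)) σs → covers (toℕ k) (map (addFixed k) σs) ≡ covers (toℕ k) σs
covers-addFixed k σs = T-injective (mk⇔
  (λ t → Equivalence.from (T-covers σs) λ y y<k →
    subst T (movedBySome-addFixed-punchIn k σs y)
      (Equivalence.to (T-covers (map (addFixed k) σs)) t (punchIn k y)
                      (subst (_< toℕ k) (sym (toℕ-punchIn-< k y y<k)) y<k)))
  (λ t → Equivalence.from (T-covers (map (addFixed k) σs)) λ p p<k → case p p<k t))
  where
  case : ∀ p → toℕ p < toℕ k → T (covers (toℕ k) σs) → T (movedBySome (map (addFixed k) σs) p)
  case p p<k t with k-or-punchIn k p
  ... | inj₁ refl       = ⊥-elim (<-irrefl refl p<k)
  ... | inj₂ (y , refl) with toℕ y <? toℕ k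
  ...   | yes y<k = subst T (sym (movedBySome-addFixed-punchIn k σs y))
                          (Equivalence.to (T-covers σs) t y y<k)
  ...   | no  y≮k = ⊥-elim (<⇒≱ p<k (subst (toℕ k ≤_) (sym (toℕ-punchIn-≥ k y k≤y)) (m≤n⇒m≤1+n k≤y)))
    where k≤y = ≮⇒≥ y≮k

¬movedBySome⇒fixed : ∀ {N} σs {p : Fin N} → ¬ T (movedBySome σs p) → All (λ σ → σ p ≡ p) σs
¬movedBySome⇒fixed []       _        = []
¬movedBySome⇒fixed (σ ∷ σs) {p} unmoved with eqFin (σ p) p in σp≟p
... | true  = Equivalence.to T-eqFin (subst T (sym σp≟p) _) ∷ ¬movedBySome⇒fixed σs unmoved
... | false = ⊥-elim (unmoved _)

module _ {N : ℕ} (k : Fin (suc N)) where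

  map-addFixed-cancel : ∀ {σs τs} → Pointwise _≗_ (map (addFixed k) σs) (map (addFixed k) τs) → Pointwise _≗_ σs τs
  map-addFixed-cancel = Pointwiseₚ.map (addFixed-cancel k) ∘ Pointwiseₚ.map⁻ (addFixed k) (addFixed k)

  map-addFixed-cong : ∀ {σs τs} → Pointwise _≗_ σs τs → Pointwise _≗_ (map (addFixed k) σs) (map (addFixed k) τs)
  map-addFixed-cong = Pointwiseₚ.map⁺ (addFixed k) (addFixed k) ∘ Pointwiseₚ.map (addFixed-cong k)

  map-addFixed-surjective : ∀ {σs} → All (Injective _≡_ _≡_) σs → All (λ σ → σ k ≡ k) σs →
    ∃ λ τs → All (Injective _≡_ _≡_) τs × Pointwise _≗_ (map (addFixed k) τs) σs
  map-addFixed-surjective []                []             = [] , [] , []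
  map-addFixed-surjective (σ-inj ∷ σs-inj) (σk≡k ∷ σsk≡k)
    with addFixed-surjective k σ-inj σk≡k | map-addFixed-surjective σs-inj σsk≡k
  ... | τ , τ-inj , addFixed-τ | τs , τs-inj , addFixed-τs = τ ∷ τs , τ-inj ∷ τs-inj , addFixed-τ ∷ addFixed-τs

totalMoved : ∀ {N} → List (Fin N → Fin N) → ℕ
totalMoved σs = sum (map (count ∘ moves) σs)

count-movedBySome : ∀ {N} (σs : List (Fin N → Fin N)) → count (movedBySome σs) ≤ totalMoved σs
count-movedBySome {N} []   = ≤-reflexive (count-none {N} {movedBySome {N} []} (λ _ ()))
count-movedBySome (σ ∷ σs) = ≤-trans (count-∨ (moves σ) (movedBySome σs)) (+-monoʳ-≤ _ (count-movedBySome σs))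

deficitsAre-totalMoved : ∀ {N} {σs : List (Fin N → Fin N)} → All (Injective _≡_ _≡_) σs →
  ∀ ls → T (deficitsAre σs ls) → totalMoved σs ≤ 2 * size ls
deficitsAre-totalMoved []               []       _ = z≤n
deficitsAre-totalMoved {N} {σ ∷ σs} (σ-inj ∷ σs-inj) (l ∷ ls) t with Equivalence.to T-∧ t
... | c+l≡N , rest = begin
  count (moves σ) + totalMoved σs      ≤⟨ +-mono-≤ (moves-bound σ-inj) (deficitsAre-totalMoved σs-inj ls rest) ⟩
  2 * (N ∸ numCycles σ) + 2 * size ls   ≡⟨ cong (λ m → 2 * m + 2 * size ls) N∸c≡l ⟩
  2 * l + 2 * size ls                   ≡⟨ *-distribˡ-+ 2 l (size ls) ⟨
  2 * (l + size ls)                     ∎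
  where
  open ≤-Reasoning
  N∸c≡l : N ∸ numCycles σ ≡ l
  N∸c≡l = trans (cong (_∸ numCycles σ) (sym (≡ᵇ⇒≡ _ _ c+l≡N))) (m+n∸m≡n (numCycles σ) l)

PaddedCycleType-moved : ∀ μ {N} {α : Fin N → Fin N} → PaddedCycleType μ α → count (moves α) ≤ size μ
PaddedCycleType-moved μ {N} {α} (fixed-ok , _) = +-cancelˡ-≤ (count (fixes α)) _ _ (begin
  count (fixes α) + count (moves α) ≡⟨ count-complement (fixes α) ⟩
  N                                 ≤⟨ m≤n+m N (mult 1 μ) ⟩
  mult 1 μ + N                      ≡⟨ fixed-ok ⟨
  numCyclesOfLen α 1 + size μ       ≡⟨ cong (_+ size μ) (numCyclesOfLen-1 α) ⟩
  count (fixes α) + size μ          ∎)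
  where open ≤-Reasoning

module _ (ls μ : List ℕ) where

  good : ∀ {N} → List (Fin N → Fin N) → Bool
  good []       = false
  good (α ∷ αs) = deficitsAre αs ls ∧ hasPaddedCycleType μ α ∧ isId (prod (αs ++ α ∷ []))

  goodCovering : ∀ {N} → ℕ → List (Fin N → Fin N) → Bool
  goodCovering K σs = good σs ∧ covers K σs

  coveringCount : ℕ → ℕ → ℕ
  coveringCount N K = length (filter (T? ∘ goodCovering K) (tuples (suc (length ls)) (Sym N)))

  good-cong : ∀ {N} {σs τs : List (Fin N → Fin N)} → Pointwise _≗_ σs τs → good σs ≡ good τs
  good-cong []                    = refl
  good-cong (α≗β ∷ αs≋βs) = cong₂ _∧_ (deficitsAre-cong αs≋βs ls)
    (cong₂ _∧_ (hasPaddedCycleType-cong μ α≗β) (isId-cong (prod-cong (Pointwiseₚ.++⁺ αs≋βs (α≗β ∷ [])))))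

  goodCovering-cong : ∀ {N} {σs τs : List (Fin N → Fin N)} → Pointwise _≗_ σs τs → ∀ K → goodCovering K σs ≡ goodCovering K τs
  goodCovering-cong σs≋τs K = cong₂ _∧_ (good-cong σs≋τs) (covers-cong σs≋τs K)

  good-addFixed : ∀ {N} (k : Fin (suc N)) {σs} → All (Injective _≡_ _≡_) σs → good (map (addFixed k) σs) ≡ good σs
  good-addFixed k []                                = refl
  good-addFixed k {α ∷ αs} (α-inj ∷ αs-inj) = cong₂ _∧_ (deficitsAre-addFixed k αs-inj ls) (cong₂ _∧_
    (hasPaddedCycleType-addFixed μ k α-inj)
    (trans (cong (isId ∘ prod) (sym (map-++ (addFixed k) αs (α ∷ [])))) (isId-prod-addFixed k (αs ++ α ∷ []))))

  module _ {N : ℕ} (k : Fin (suc N)) where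
    private
      K r : ℕ
      K = toℕ k
      r = suc (length ls)
      open MembershipSetoid (TupleSetoid N) using () renaming (_∈_ to _∈ₙ_)
      open MembershipSetoid (TupleSetoid (suc N)) using () renaming (_∈_ to _∈ₙ₊₁_)
      fixesK : List (Fin (suc N) → Fin (suc N)) → Bool
      fixesK σs = goodCovering K σs ∧ not (movedBySome σs k)
      Small : List (List (Fin N → Fin N))
      Small = filter (T? ∘ goodCovering K) (tuples r (Sym N))
      Fixing Image : List (List (Fin (suc N) → Fin (suc N)))
      Fixing = filter (T? ∘ fixesK) (tuples r (Sym (suc N)))
      Image = map (map (addFixed k)) Small
      fixesK-resp : ∀ {σs τs} → Pointwise _≗_ σs τs → T (fixesK σs) → T (fixesK τs)
      fixesK-resp σs≋τs = subst T (cong₂ (λ b c → b ∧ not c) (goodCovering-cong σs≋τs K) (movedBySome-cong σs≋τs k))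
      goodCovering-resp : ∀ {σs τs : List (Fin N → Fin N)} → Pointwise _≗_ σs τs →
        T (goodCovering K σs) → T (goodCovering K τs)
      goodCovering-resp σs≋τs = subst T (goodCovering-cong σs≋τs K)
      ∈-Small⁺ : ∀ {σs} → σs ∈ₙ tuples r (Sym N) → T (goodCovering K σs) → σs ∈ₙ Small
      ∈-Small⁺ = Membershipₚ.∈-filter⁺ (TupleSetoid N) (T? ∘ goodCovering K) goodCovering-resp
      ∈-Small⁻ : ∀ {σs} → σs ∈ₙ Small → σs ∈ₙ tuples r (Sym N) × T (goodCovering K σs)
      ∈-Small⁻ = Membershipₚ.∈-filter⁻ (TupleSetoid N) (T? ∘ goodCovering K) goodCovering-resp
      ∈-Fixing⁺ : ∀ {σs} → σs ∈ₙ₊₁ tuples r (Sym (suc N)) → T (fixesK σs) → σs ∈ₙ₊₁ Fixing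
      ∈-Fixing⁺ = Membershipₚ.∈-filter⁺ (TupleSetoid (suc N)) (T? ∘ fixesK) fixesK-resp
      ∈-Fixing⁻ : ∀ {σs} → σs ∈ₙ₊₁ Fixing → σs ∈ₙ₊₁ tuples r (Sym (suc N)) × T (fixesK σs)
      ∈-Fixing⁻ = Membershipₚ.∈-filter⁻ (TupleSetoid (suc N)) (T? ∘ fixesK) fixesK-resp

    fixesK-addFixed : ∀ {σs} → All (Injective _≡_ _≡_) σs → fixesK (map (addFixed k) σs) ≡ goodCovering K σs
    fixesK-addFixed {σs} σs-inj = begin
      (good (map (addFixed k) σs) ∧ covers K (map (addFixed k) σs)) ∧ not (movedBySome (map (addFixed k) σs) k)
        ≡⟨ cong₂ (λ b c → b ∧ not c) (cong₂ _∧_ (good-addFixed k σs-inj) (covers-addFixed k σs))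
                 (movedBySome-addFixed-k k σs) ⟩
      goodCovering K σs ∧ true ≡⟨ ∧-identityʳ _ ⟩
      goodCovering K σs ∎
      where open ≡-Reasoning

    Fixing⊆Image : ∀ {σs} → σs ∈ₙ₊₁ Fixing → σs ∈ₙ₊₁ Image
    Fixing⊆Image {σs} σs∈Fixing with ∈-Fixing⁻ σs∈Fixing
    ... | σs∈Tuples , σs-fixesK with ∈-tuples-Sym⁻ r σs∈Tuples
    ... | len , σs-inj with map-addFixed-surjective k σs-inj
                              (¬movedBySome⇒fixed σs (T-not⇒¬T (proj₂ (Equivalence.to T-∧ σs-fixesK))))
    ... | τs , τs-inj , τs⁺≋σs = Membershipₚ.∈-resp-≈ (TupleSetoid (suc N)) τs⁺≋σs
          (Membershipₚ.∈-map⁺ (TupleSetoid N) (TupleSetoid (suc N)) (map-addFixed-cong k) τs∈Small)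
      where
      τs∈Small : τs ∈ₙ Small
      τs∈Small = ∈-Small⁺
        (∈-tuples-Sym⁺ r (trans (sym (length-map (addFixed k) τs)) (trans (Pointwise-length τs⁺≋σs) len)) τs-inj)
        (subst T (fixesK-addFixed τs-inj) (fixesK-resp (ListEquality.≋-sym (FunSetoid _ _) τs⁺≋σs) σs-fixesK))

    Image⊆Fixing : ∀ {σs} → σs ∈ₙ₊₁ Image → σs ∈ₙ₊₁ Fixing
    Image⊆Fixing σs∈Image with Membershipₚ.∈-map⁻ (TupleSetoid N) (TupleSetoid (suc N)) σs∈Image
    ... | τs , τs∈Small , σs≋τs⁺ with ∈-Small⁻ τs∈Small
    ... | τs∈Tuples , τs-good with ∈-tuples-Sym⁻ r τs∈Tuples
    ... | len , τs-inj = Membershipₚ.∈-resp-≈ (TupleSetoid (suc N)) (ListEquality.≋-sym (FunSetoid _ _) σs≋τs⁺)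
          (∈-Fixing⁺ (∈-tuples-Sym⁺ r (trans (length-map (addFixed k) τs) len) (map⁺ (All.map (addFixed-injective k) τs-inj)))
                     (subst T (sym (fixesK-addFixed τs-inj)) τs-good))

    length-Fixing : length Fixing ≡ coveringCount N K
    length-Fixing = begin
      length Fixing ≡⟨ Unique-⊆⊇⇒length≡ (TupleSetoid (suc N)) Fixing! Image! Fixing⊆Image Image⊆Fixing ⟩
      length Image  ≡⟨ length-map (map (addFixed k)) Small ⟩
      length Small  ∎
      where
      open ≡-Reasoning
      Fixing! = Uniqueₚ.filter⁺ (TupleSetoid (suc N)) (T? ∘ fixesK)
        (tuples-unique (FunSetoid _ _) r (Sym-unique (suc N)))
      Image! = Uniqueₚ.map⁺ (TupleSetoid N) (TupleSetoid (suc N)) (map-addFixed-cancel k)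
        (Uniqueₚ.filter⁺ (TupleSetoid N) (T? ∘ goodCovering K) (tuples-unique (FunSetoid _ _) r (Sym-unique N)))

    coveringCount-step : coveringCount (suc N) K ≡ coveringCount N K + coveringCount (suc N) (suc K)
    coveringCount-step = begin
      coveringCount (suc N) K
        ≡⟨ length-filter-split (goodCovering K) (λ σs → movedBySome σs k) (tuples r (Sym (suc N))) ⟩
      length (filter (T? ∘ λ σs → goodCovering K σs ∧ movedBySome σs k) (tuples r (Sym (suc N)))) + length Fixing
        ≡⟨ cong₂ _+_ (cong length (filter-≗ moving≗next (tuples r (Sym (suc N))))) length-Fixing ⟩
      coveringCount (suc N) (suc K) + coveringCount N K
        ≡⟨ +-comm (coveringCount (suc N) (suc K)) (coveringCount N K) ⟩
      coveringCount N K + coveringCount (suc N) (suc K) ∎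
      where
      open ≡-Reasoning
      moving≗next : ∀ σs → goodCovering K σs ∧ movedBySome σs k ≡ goodCovering (suc K) σs
      moving≗next σs = trans (∧-assoc (good σs) _ _) (cong (good σs ∧_) (sym (covers-suc σs k)))

  maxMoved : ℕ
  maxMoved = size μ + 2 * size ls

  good-totalMoved : ∀ {N} {σs : List (Fin N → Fin N)} → All (Injective _≡_ _≡_) σs → T (good σs) → totalMoved σs ≤ maxMoved
  good-totalMoved {σs = α ∷ αs} (α-inj ∷ αs-inj) t with Equivalence.to T-∧ t
  ... | deficits-ok , rest = +-mono-≤
    (PaddedCycleType-moved μ (Equivalence.to (T-hasPaddedCycleType μ α) (proj₁ (Equivalence.to T-∧ rest))))
    (deficitsAre-totalMoved αs-inj ls deficits-ok)

  coveringCount-vanishes : ∀ {N} → maxMoved < N → coveringCount N N ≡ 0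
  coveringCount-vanishes {N} maxMoved<N = cong length (filter-none (T? ∘ goodCovering N)
    (All.map (λ (_ , σs-inj) → not-covering σs-inj) (All-tuples (suc (length ls)) (Sym-injective N))))
    where
    not-covering : ∀ {σs} → All (Injective _≡_ _≡_) σs → ¬ T (goodCovering N σs)
    not-covering {σs} σs-inj t with Equivalence.to T-∧ t
    ... | σs-good , σs-covers = <⇒≱ maxMoved<N (begin
      N                         ≡⟨ count-all (covers-everything σs σs-covers) ⟨
      count (movedBySome σs)    ≤⟨ count-movedBySome σs ⟩
      totalMoved σs             ≤⟨ good-totalMoved σs-inj σs-good ⟩
      maxMoved                  ∎)
      where open ≤-Reasoning

  coveringCount-recurrence : ∀ {N K} → K ≤ N → coveringCount (suc N) K ≡ coveringCount N K + coveringCount (suc N) (suc K)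
  coveringCount-recurrence {N} K≤N =
    subst (λ K → coveringCount (suc N) K ≡ coveringCount N K + coveringCount (suc N) (suc K))
          (toℕ-fromℕ< (s≤s K≤N)) (coveringCount-step (fromℕ< (s≤s K≤N)))

  module _ {N : ℕ} (Σμ≤N : size μ ≤ suc N) where
    private
      goodCons≡goodCovering : ∀ α αs →
        (cycleCountsAre αs (map (suc N ∸_) ls) ∧ hasCycleType α (padOnes μ (suc N)) ∧ isId (prod (αs ++ α ∷ [])))
          ≡ goodCovering 0 (α ∷ αs)
      goodCons≡goodCovering α αs = begin
        cycleCountsAre αs (map (suc N ∸_) ls) ∧ hasCycleType α (padOnes μ (suc N)) ∧ isId (prod (αs ++ α ∷ []))
          ≡⟨ cong₂ _∧_ (cycleCountsAre-complement αs ls) (cong (_∧ isId (prod (αs ++ α ∷ []))) type≡padded) ⟩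
        good (α ∷ αs)                 ≡⟨ ∧-identityʳ (good (α ∷ αs)) ⟨
        good (α ∷ αs) ∧ true          ≡⟨ cong (good (α ∷ αs) ∧_) (covers-zero (α ∷ αs)) ⟨
        goodCovering 0 (α ∷ αs)       ∎
        where
        open ≡-Reasoning
        type≡padded : hasCycleType α (padOnes μ (suc N)) ≡ hasPaddedCycleType μ α
        type≡padded = T-injective (⇔-sym (T-hasPaddedCycleType μ α) ⇔-∘ hasCycleType-padOnes μ α Σμ≤N)

      -- `countTuples` filters with a local predicate that cannot be named; unification recovers it as the
      -- left-hand predicate of `filter-≗`.
      countTuples≡filter : countTuples (suc N) (map (suc N ∸_) ls) (padOnes μ (suc N)) ≡
        length (filter (T? ∘ goodCovering 0) (tuples (suc (length (map (suc N ∸_) ls))) (Sym (suc N))))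
      countTuples≡filter
        with tuples (suc (length (map (suc N ∸_) ls))) (Sym (suc N))
           | (λ ts → cong length (filter-≗ {Q = goodCovering 0}
                                            (λ { [] → refl ; (α ∷ αs) → goodCons≡goodCovering α αs }) ts))
      ... | ts | same-length = same-length ts

    countTuples≡coveringCount : countTuples (suc N) (map (suc N ∸_) ls) (padOnes μ (suc N)) ≡ coveringCount (suc N) 0
    countTuples≡coveringCount = trans countTuples≡filter
      (cong (λ m → length (filter (T? ∘ goodCovering 0) (tuples (suc m) (Sym (suc N))))) (length-map (suc N ∸_) ls))

-- Newton's formula and polynomials

∑< : ℕ → (ℕ → ℕ) → ℕ
∑< zero    f = 0
∑< (suc L) f = f 0 + ∑< L (f ∘ suc)

∑<-cong : ∀ L {f g : ℕ → ℕ} → (∀ j → f j ≡ g j) → ∑< L f ≡ ∑< L g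
∑<-cong zero    f≗g = refl
∑<-cong (suc L) f≗g = cong₂ _+_ (f≗g 0) (∑<-cong L (f≗g ∘ suc))

∑<-+ : ∀ L (f g : ℕ → ℕ) → ∑< L (λ j → f j + g j) ≡ ∑< L f + ∑< L g
∑<-+ zero    f g = refl
∑<-+ (suc L) f g = trans (cong (f 0 + g 0 +_) (∑<-+ L (f ∘ suc) (g ∘ suc))) (interchange (f 0) (g 0) _ _)
  where
  interchange : ∀ a b c d → a + b + (c + d) ≡ a + c + (b + d)
  interchange = solve-∀

∑<-last : ∀ L (f : ℕ → ℕ) → ∑< (suc L) f ≡ ∑< L f + f L
∑<-last zero    f = +-identityʳ (f 0)
∑<-last (suc L) f = trans (cong (f 0 +_) (∑<-last L (f ∘ suc))) (sym (+-assoc (f 0) _ _))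

∑<-zero : ∀ L {f : ℕ → ℕ} → (∀ j → f j ≡ 0) → ∑< L f ≡ 0
∑<-zero zero    f≡0 = refl
∑<-zero (suc L) f≡0 = cong₂ _+_ (f≡0 0) (∑<-zero L (f≡0 ∘ suc))

pascal : ∀ n k → suc n C suc k ≡ n C k + n C suc k
pascal n k = sym (nCk+nC[k+1]≡[n+1]C[k+1] n k)

-- Newton's forward-difference formula, truncated at M: `h (k + j) 0` is the j-th forward difference of `h k` at 0.
module BinomialExpansion (h : ℕ → ℕ → ℕ) (h-pascal : ∀ k n → h k (suc n) ≡ h k n + h (suc k) n)
                         (M : ℕ) (h-vanishes : ∀ j → M < j → h j 0 ≡ 0) where

  private
    a : ℕ → ℕ
    a j = h j 0

    term : ℕ → ℕ → ℕ → ℕ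
    term n k j = (n C j) * a (k + j)

    term-pascal : ∀ n k j → term (suc n) k (suc j) ≡ term n k (suc j) + term n (suc k) j
    term-pascal n k j = begin
      (suc n C suc j) * a (k + suc j)                         ≡⟨ cong (_* a (k + suc j)) (pascal n j) ⟩
      ((n C j) + (n C suc j)) * a (k + suc j)                 ≡⟨ *-distribʳ-+ (a (k + suc j)) (n C j) (n C suc j) ⟩
      (n C j) * a (k + suc j) + (n C suc j) * a (k + suc j)   ≡⟨ +-comm ((n C j) * a (k + suc j)) _ ⟩
      (n C suc j) * a (k + suc j) + (n C j) * a (k + suc j)   ≡⟨ cong (λ i → term n k (suc j) + (n C j) * a i) (+-suc k j) ⟩
      term n k (suc j) + term n (suc k) j                     ∎
      where open ≡-Reasoning

  expansion : ∀ n k → h k n ≡ ∑< (suc M) (λ j → (n C j) * h (k + j) 0)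
  expansion zero    k = sym (begin
    1 * a (k + 0) + ∑< M (term 0 k ∘ suc) ≡⟨ cong (1 * a (k + 0) +_) (∑<-zero M (λ _ → refl)) ⟩
    1 * a (k + 0) + 0                     ≡⟨ +-identityʳ _ ⟩
    1 * a (k + 0)                         ≡⟨ *-identityˡ _ ⟩
    a (k + 0)                             ≡⟨ cong a (+-identityʳ k) ⟩
    h k 0                                 ∎)
    where open ≡-Reasoning
  expansion (suc n) k = begin
    h k (suc n)                                                   ≡⟨ h-pascal k n ⟩
    h k n + h (suc k) n                                           ≡⟨ cong₂ _+_ (expansion n k) (expansion n (suc k)) ⟩
    ∑< (suc M) (term n k) + ∑< (suc M) (term n (suc k))           ≡⟨ cong (∑< (suc M) (term n k) +_) last-vanishes ⟩
    term n k 0 + ∑< M (term n k ∘ suc) + ∑< M (term n (suc k))    ≡⟨ +-assoc (term n k 0) _ _ ⟩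
    term n k 0 + (∑< M (term n k ∘ suc) + ∑< M (term n (suc k)))  ≡⟨ cong (term n k 0 +_) (∑<-+ M _ _) ⟨
    term n k 0 + ∑< M (λ j → term n k (suc j) + term n (suc k) j) ≡⟨ cong (term n k 0 +_) (∑<-cong M (sym ∘ term-pascal n k)) ⟩
    ∑< (suc M) (term (suc n) k)                                   ∎
    where
    open ≡-Reasoning
    S = ∑< M (term n (suc k))
    last-vanishes : ∑< (suc M) (term n (suc k)) ≡ S
    last-vanishes = begin
      ∑< (suc M) (term n (suc k))                        ≡⟨ ∑<-last M _ ⟩
      ∑< M (term n (suc k)) + (n C M) * a (suc k + M)    ≡⟨ cong (λ x → S + (n C M) * x) (h-vanishes _ (s≤s (m≤n+m M k))) ⟩
      ∑< M (term n (suc k)) + (n C M) * 0                ≡⟨ cong (S +_) (*-zeroʳ (n C M)) ⟩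
      ∑< M (term n (suc k)) + 0                          ≡⟨ +-identityʳ _ ⟩
      ∑< M (term n (suc k))                              ∎

-- `n P′ k` is the falling factorial n (n − 1) ⋯ (n − k + 1), which is 0 when k > n.
P′-suc : ∀ n k → suc n P′ suc k ≡ suc n * (n P′ k)
P′-suc n zero    = refl
P′-suc n (suc k) = begin
  (n ∸ k) * (suc n P′ suc k)    ≡⟨ cong ((n ∸ k) *_) (P′-suc n k) ⟩
  (n ∸ k) * (suc n * (n P′ k))  ≡⟨ swap-left (n ∸ k) (suc n) (n P′ k) ⟩
  suc n * ((n ∸ k) * (n P′ k))  ∎
  where
  open ≡-Reasoning
  swap-left : ∀ a b c → a * (b * c) ≡ b * (a * c)
  swap-left = solve-∀

P′-vanishes : ∀ {n k} → n ≤ k → n P′ suc k ≡ 0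
P′-vanishes {n} {k} n≤k = cong (_* (n P′ k)) (m≤n⇒m∸n≡0 n≤k)

k!*nCk≡nP′k : ∀ n k → k ! * (n C k) ≡ n P′ k
k!*nCk≡nP′k n       zero    = refl
k!*nCk≡nP′k zero    (suc k) = trans (*-zeroʳ (suc k !)) (sym (cong (_* (0 P′ k)) (0∸n≡0 k)))
k!*nCk≡nP′k (suc n) (suc k) = begin
  suc k ! * (suc n C suc k)                      ≡⟨ cong (suc k ! *_) (pascal n k) ⟩
  suc k ! * ((n C k) + (n C suc k))              ≡⟨ *-distribˡ-+ (suc k !) (n C k) (n C suc k) ⟩
  suc k * k ! * (n C k) + suc k ! * (n C suc k)
    ≡⟨ cong₂ _+_ (trans (*-assoc (suc k) (k !) (n C k)) (cong (suc k *_) (k!*nCk≡nP′k n k))) (k!*nCk≡nP′k n (suc k)) ⟩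
  suc k * (n P′ k) + (n ∸ k) * (n P′ k)          ≡⟨ *-distribʳ-+ (n P′ k) (suc k) (n ∸ k) ⟨
  (suc k + (n ∸ k)) * (n P′ k)                   ≡⟨ collapse ⟩
  suc n * (n P′ k)                               ≡⟨ P′-suc n k ⟨
  suc n P′ suc k                                 ∎
  where
  open ≡-Reasoning
  collapse : (suc k + (n ∸ k)) * (n P′ k) ≡ suc n * (n P′ k)
  collapse with k ≤? n
  ... | yes k≤n = cong (λ m → suc m * (n P′ k)) (m+[n∸m]≡n k≤n)
  ... | no  k≰n = begin
    (suc k + (n ∸ k)) * (n P′ k) ≡⟨ cong ((suc k + (n ∸ k)) *_) nP′k≡0 ⟩
    (suc k + (n ∸ k)) * 0        ≡⟨ *-zeroʳ (suc k + (n ∸ k)) ⟩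
    0                            ≡⟨ *-zeroʳ (suc n) ⟨
    suc n * 0                    ≡⟨ cong (suc n *_) nP′k≡0 ⟨
    suc n * (n P′ k)             ∎
    where
    nP′k≡0 : n P′ k ≡ 0
    nP′k≡0 with ≰⇒> k≰n
    ... | s≤s n≤k-1 = P′-vanishes n≤k-1

ℚ-ring : ACR.AlmostCommutativeRing 0ℓ 0ℓ
ℚ-ring = ACR.fromCommutativeRing ℚₚ.+-*-commutativeRing (λ x → dec⇒maybe (ℚ.0ℚ ℚₚ.≟ x))

Polynomial : Set
Polynomial = List ℚ

infixl 6 _+ₚ_
infixr 7 _·ₚ_

_+ₚ_ : Polynomial → Polynomial → Polynomial
[]       +ₚ q        = q
(a ∷ p) +ₚ []       = a ∷ p
(a ∷ p) +ₚ (b ∷ q) = (a ℚ.+ b) ∷ (p +ₚ q)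

_·ₚ_ : ℚ → Polynomial → Polynomial
c ·ₚ p = map (c ℚ.*_) p

eval-+ₚ : ∀ p q x → evalPoly (p +ₚ q) x ≡ evalPoly p x ℚ.+ evalPoly q x
eval-+ₚ []      q       x = sym (ℚₚ.+-identityˡ _)
eval-+ₚ (a ∷ p) []      x = sym (ℚₚ.+-identityʳ _)
eval-+ₚ (a ∷ p) (b ∷ q) x = begin
  (a ℚ.+ b) ℚ.+ x ℚ.* evalPoly (p +ₚ q) x                          ≡⟨ cong (λ e → (a ℚ.+ b) ℚ.+ x ℚ.* e) (eval-+ₚ p q x) ⟩
  (a ℚ.+ b) ℚ.+ x ℚ.* (evalPoly p x ℚ.+ evalPoly q x)              ≡⟨ regroup a b x (evalPoly p x) (evalPoly q x) ⟩
  (a ℚ.+ x ℚ.* evalPoly p x) ℚ.+ (b ℚ.+ x ℚ.* evalPoly q x)        ∎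
  where
  open ≡-Reasoning
  regroup : ∀ a b x u v → (a ℚ.+ b) ℚ.+ x ℚ.* (u ℚ.+ v) ≡ (a ℚ.+ x ℚ.* u) ℚ.+ (b ℚ.+ x ℚ.* v)
  regroup = RingSolver.solve-∀ ℚ-ring

eval-·ₚ : ∀ c p x → evalPoly (c ·ₚ p) x ≡ c ℚ.* evalPoly p x
eval-·ₚ c []      x = sym (ℚₚ.*-zeroʳ c)
eval-·ₚ c (a ∷ p) x = begin
  c ℚ.* a ℚ.+ x ℚ.* evalPoly (c ·ₚ p) x   ≡⟨ cong (λ e → c ℚ.* a ℚ.+ x ℚ.* e) (eval-·ₚ c p x) ⟩
  c ℚ.* a ℚ.+ x ℚ.* (c ℚ.* evalPoly p x)  ≡⟨ regroup c a x (evalPoly p x) ⟩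
  c ℚ.* (a ℚ.+ x ℚ.* evalPoly p x)        ∎
  where
  open ≡-Reasoning
  regroup : ∀ c a x u → c ℚ.* a ℚ.+ x ℚ.* (c ℚ.* u) ≡ c ℚ.* (a ℚ.+ x ℚ.* u)
  regroup = RingSolver.solve-∀ ℚ-ring

toℚ≡mkℚ : ∀ n → toℚ n ≡ ℚ.mkℚ (ℤ.+ n) 0 (Coprime.sym (Coprime.1-coprimeTo n))
toℚ≡mkℚ n = ℚₚ.↥p/↧p≡p (ℚ.mkℚ (ℤ.+ n) 0 (Coprime.sym (Coprime.1-coprimeTo n)))

toℚ-+ : ∀ m n → toℚ (m + n) ≡ toℚ m ℚ.+ toℚ n
toℚ-+ m n rewrite toℚ≡mkℚ m | toℚ≡mkℚ n =
  cong (ℚ._/ 1) (trans (ℤₚ.pos-+ m n) (sym (cong₂ ℤ._+_ (ℤₚ.*-identityʳ (ℤ.+ m)) (ℤₚ.*-identityʳ (ℤ.+ n)))))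

toℚ-* : ∀ m n → toℚ (m * n) ≡ toℚ m ℚ.* toℚ n
toℚ-* m n rewrite toℚ≡mkℚ m | toℚ≡mkℚ n = cong (ℚ._/ 1) (ℤₚ.pos-* m n)

toℚ-∸ : ∀ {m n} → n ≤ m → toℚ (m ∸ n) ≡ toℚ m ℚ.- toℚ n
toℚ-∸ {m} {n} n≤m = begin
  toℚ (m ∸ n)                          ≡⟨ add-sub (toℚ (m ∸ n)) (toℚ n) ⟩
  (toℚ (m ∸ n) ℚ.+ toℚ n) ℚ.- toℚ n    ≡⟨ cong (ℚ._- toℚ n) (toℚ-+ (m ∸ n) n) ⟨
  toℚ (m ∸ n + n) ℚ.- toℚ n            ≡⟨ cong (λ k → toℚ k ℚ.- toℚ n) (m∸n+n≡m n≤m) ⟩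
  toℚ m ℚ.- toℚ n                      ∎
  where
  open ≡-Reasoning
  add-sub : ∀ a b → a ≡ (a ℚ.+ b) ℚ.- b
  add-sub = RingSolver.solve-∀ ℚ-ring

factorial-invertible : ∀ n → ∃ λ c → c ℚ.* toℚ (n !) ≡ ℚ.1ℚ
factorial-invertible n with n ! | n !≢0
... | suc m | _ = ℚ.1/ q , trans (cong (ℚ.1/ q ℚ.*_) (toℚ≡mkℚ (suc m))) (ℚₚ.*-inverseˡ q)
  where
  q = ℚ.mkℚ (ℤ.+ suc m) 0 (Coprime.sym (Coprime.1-coprimeTo (suc m)))

IsPolynomial : (ℕ → ℚ) → Set
IsPolynomial f = Σ Polynomial λ A → ∀ n → f n ≡ evalPoly A (toℚ n)

module _ {f g : ℕ → ℚ} where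

  IsPolynomial-+ : IsPolynomial f → IsPolynomial g → IsPolynomial (λ n → f n ℚ.+ g n)
  IsPolynomial-+ (A , f≡A) (B , g≡B) = A +ₚ B , λ n → trans (cong₂ ℚ._+_ (f≡A n) (g≡B n)) (sym (eval-+ₚ A B (toℚ n)))

  IsPolynomial-resp : (∀ n → f n ≡ g n) → IsPolynomial f → IsPolynomial g
  IsPolynomial-resp f≗g (A , f≡A) = A , λ n → trans (sym (f≗g n)) (f≡A n)

IsPolynomial-· : ∀ c {f} → IsPolynomial f → IsPolynomial (λ n → c ℚ.* f n)
IsPolynomial-· c (A , f≡A) = c ·ₚ A , λ n → trans (cong (c ℚ.*_) (f≡A n)) (sym (eval-·ₚ c A (toℚ n)))

fallingPoly : ℕ → Polynomial
fallingPoly zero    = ℚ.1ℚ ∷ []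
fallingPoly (suc j) = (ℚ.0ℚ ∷ fallingPoly j) +ₚ (ℚ.- toℚ j) ·ₚ fallingPoly j

eval-fallingPoly : ∀ j n → evalPoly (fallingPoly j) (toℚ n) ≡ toℚ (n P′ j)
eval-fallingPoly zero    n = one-plus-zero (toℚ n)
  where
  one-plus-zero : ∀ x → ℚ.1ℚ ℚ.+ x ℚ.* ℚ.0ℚ ≡ ℚ.1ℚ
  one-plus-zero = RingSolver.solve-∀ ℚ-ring
eval-fallingPoly (suc j) n = begin
  evalPoly (fallingPoly (suc j)) x                    ≡⟨ eval-+ₚ (ℚ.0ℚ ∷ fallingPoly j) (-j ·ₚ fallingPoly j) x ⟩
  (ℚ.0ℚ ℚ.+ x ℚ.* p) ℚ.+ evalPoly (-j ·ₚ fallingPoly j) x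
    ≡⟨ cong ((ℚ.0ℚ ℚ.+ x ℚ.* p) ℚ.+_) (eval-·ₚ -j (fallingPoly j) x) ⟩
  (ℚ.0ℚ ℚ.+ x ℚ.* p) ℚ.+ -j ℚ.* p                    ≡⟨ factor x p (toℚ j) ⟩
  (x ℚ.- toℚ j) ℚ.* p                                 ≡⟨ cong ((x ℚ.- toℚ j) ℚ.*_) (eval-fallingPoly j n) ⟩
  (x ℚ.- toℚ j) ℚ.* toℚ (n P′ j)                      ≡⟨ next-factor ⟩
  toℚ (n P′ suc j)                                    ∎
  where
  open ≡-Reasoning
  x = toℚ n
  -j = ℚ.- toℚ j
  p = evalPoly (fallingPoly j) x
  factor : ∀ x p c → (ℚ.0ℚ ℚ.+ x ℚ.* p) ℚ.+ (ℚ.- c) ℚ.* p ≡ (x ℚ.- c) ℚ.* p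
  factor = RingSolver.solve-∀ ℚ-ring
  next-factor : (x ℚ.- toℚ j) ℚ.* toℚ (n P′ j) ≡ toℚ (n P′ suc j)
  next-factor with j ≤? n
  ... | yes j≤n = sym (trans (toℚ-* (n ∸ j) (n P′ j)) (cong (ℚ._* toℚ (n P′ j)) (toℚ-∸ j≤n)))
  ... | no  j≰n = begin
    (x ℚ.- toℚ j) ℚ.* toℚ (n P′ j) ≡⟨ cong (λ k → (x ℚ.- toℚ j) ℚ.* toℚ k) nP′j≡0 ⟩
    (x ℚ.- toℚ j) ℚ.* ℚ.0ℚ          ≡⟨ ℚₚ.*-zeroʳ (x ℚ.- toℚ j) ⟩
    ℚ.0ℚ                            ≡⟨ cong toℚ (P′-vanishes (<⇒≤ (≰⇒> j≰n))) ⟨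
    toℚ (n P′ suc j)                ∎
    where
    nP′j≡0 : n P′ j ≡ 0
    nP′j≡0 with ≰⇒> j≰n
    ... | s≤s n≤j-1 = P′-vanishes n≤j-1

IsPolynomial-C : ∀ j → IsPolynomial (λ n → toℚ (n C j))
IsPolynomial-C j with factorial-invertible j
... | c , c*j!≡1 = IsPolynomial-resp c*nP′j≡nCj (IsPolynomial-· c (fallingPoly j , λ n → sym (eval-fallingPoly j n)))
  where
  c*nP′j≡nCj : ∀ n → c ℚ.* toℚ (n P′ j) ≡ toℚ (n C j)
  c*nP′j≡nCj n = begin
    c ℚ.* toℚ (n P′ j)                     ≡⟨ cong (λ m → c ℚ.* toℚ m) (k!*nCk≡nP′k n j) ⟨
    c ℚ.* toℚ (j ! * (n C j))              ≡⟨ cong (c ℚ.*_) (toℚ-* (j !) (n C j)) ⟩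
    c ℚ.* (toℚ (j !) ℚ.* toℚ (n C j))      ≡⟨ ℚₚ.*-assoc c (toℚ (j !)) (toℚ (n C j)) ⟨
    (c ℚ.* toℚ (j !)) ℚ.* toℚ (n C j)      ≡⟨ cong (ℚ._* toℚ (n C j)) c*j!≡1 ⟩
    ℚ.1ℚ ℚ.* toℚ (n C j)                   ≡⟨ ℚₚ.*-identityˡ (toℚ (n C j)) ⟩
    toℚ (n C j)                            ∎
    where open ≡-Reasoning

IsPolynomial-∑< : ∀ L (F : ℕ → ℕ → ℕ) → (∀ j → IsPolynomial (λ n → toℚ (F j n))) →
  IsPolynomial (λ n → toℚ (∑< L (λ j → F j n)))
IsPolynomial-∑< zero    F F-poly = [] , λ n → refl
IsPolynomial-∑< (suc L) F F-poly = IsPolynomial-resp (λ n → sym (toℚ-+ (F 0 n) _))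
  (IsPolynomial-+ (F-poly 0) (IsPolynomial-∑< L (F ∘ suc) (F-poly ∘ suc)))

IsPolynomial-binomialSum : ∀ L (c : ℕ → ℕ) → IsPolynomial (λ n → toℚ (∑< L (λ j → (n C j) * c j)))
IsPolynomial-binomialSum L c = IsPolynomial-∑< L (λ j n → (n C j) * c j) λ j →
  IsPolynomial-resp (λ n → trans (ℚₚ.*-comm (toℚ (c j)) (toℚ (n C j))) (sym (toℚ-* (n C j) (c j))))
                    (IsPolynomial-· (toℚ (c j)) (IsPolynomial-C j))

module _ (ls μ : List ℕ) where

  shiftedCount : ℕ → ℕ → ℕ
  shiftedCount k n = coveringCount ls μ (k + n) k

  shiftedCount-pascal : ∀ k n → shiftedCount k (suc n) ≡ shiftedCount k n + shiftedCount (suc k) n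
  shiftedCount-pascal k n rewrite +-suc k n = coveringCount-recurrence ls μ (m≤m+n k n)

  shiftedCount-vanishes : ∀ j → maxMoved ls μ < j → shiftedCount j 0 ≡ 0
  shiftedCount-vanishes j maxMoved<j rewrite +-identityʳ j = coveringCount-vanishes ls μ maxMoved<j

  open BinomialExpansion shiftedCount shiftedCount-pascal (maxMoved ls μ) shiftedCount-vanishes public
    using (expansion)

subscript≡map : ∀ r λs n → subscript r λs n ≡ map (n ∸_) (λs ++ replicate (r ∸ length λs) 0)
subscript≡map r λs n =
  sym (trans (map-++ (n ∸_) λs _) (cong (map (n ∸_) λs ++_) (map-replicate (n ∸_) (r ∸ length λs) 0)))

theorem4p1 : (r : ℕ) → 1 ≤ r → (λs μ : List ℕ) → Partition λs → length λs ≤ r → Partition μ →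
    ∃ λ (A : List ℚ) → (n : ℕ) → 1 ≤ n → n ≥ size μ →
      toℚ (countTuples n (subscript r λs n) (padOnes μ n)) ≡ evalPoly A (toℚ n)
theorem4p1 r _ λs μ _ _ _ = proj₁ polynomial , λ { (suc n) _ Σμ≤n → begin
    toℚ (countTuples (suc n) (subscript r λs (suc n)) (padOnes μ (suc n)))
      ≡⟨ cong (λ ks → toℚ (countTuples (suc n) ks (padOnes μ (suc n)))) (subscript≡map r λs (suc n)) ⟩
    toℚ (countTuples (suc n) (map (suc n ∸_) ls) (padOnes μ (suc n)))
      ≡⟨ cong toℚ (countTuples≡coveringCount ls μ Σμ≤n) ⟩
    toℚ (shiftedCount ls μ 0 (suc n))
      ≡⟨ cong toℚ (expansion ls μ (suc n) 0) ⟩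
    toℚ (∑< (suc (maxMoved ls μ)) (λ j → (suc n C j) * shiftedCount ls μ j 0))
      ≡⟨ proj₂ polynomial (suc n) ⟩
    evalPoly (proj₁ polynomial) (toℚ (suc n)) ∎ }
  where
  open ≡-Reasoning
  ls = λs ++ replicate (r ∸ length λs) 0
  polynomial = IsPolynomial-binomialSum (suc (maxMoved ls μ)) (λ j → shiftedCount ls μ j 0)
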